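{- Let $G$ be a connected chordal graph containing no $K_4$ (complete graph on $4$ vertices) as a subgraph. Then all roots of the clique polynomial $C(G,x)$ are real (i.e. $G$ has only clique roots).
   Context: All graphs are finite, simple and undirected. A chordal graph is a graph in which every cycle of length greater than three has a chord (an edge joining two non-consecutive vertices of the cycle). For a graph $G$, let $c_k(G)$ denote the number of cliques (sets of pairwise adjacent vertices) with $k$ vertices, with $c_0(G)=1$, and let $\omega(G)$ be the size of a largest clique. The clique polynomial of $G$ is $C(G,x)=\sum_{k=0}^{\omega(G)} c_k(G)x^k$. "$G$ has only clique roots" means all roots of $C(G,x)$ are real. -}

module Defs where

open import Level using (Level; _⊔_) renaming (suc to lsuc)
open import Data.Nat using (ℕ; zero; suc; _≡ᵇ_) renaming (_+_ to _+ℕ_)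
open import Data.Bool using (Bool; true; false; _∧_; _∨_; not; if_then_else_)
open import Data.Fin using (Fin; toℕ; _≟_)
open import Data.Vec using (Vec; []; _∷_; lookup)
open import Data.List using (List; []; _∷_; _++_; map; length; filterᵇ; allFin)
open import Data.Bool.ListAction using (and)
open import Data.Product using (Σ; ∃; ∃-syntax; _×_; _,_; proj₁; proj₂)
open import Data.Sum using (_⊎_)
open import Relation.Nullary using (¬_; does)
open import Relation.Binary.PropositionalEquality using (_≡_; _≢_)
open import Relation.Binary.Structures using (IsTotalOrder)
open import Algebra.Bundles using (CommutativeRing)
open import Function.Definitions using (Injective)

record Graph : Set where
  field
    n     : ℕ
    adj   : Fin n → Fin n → Bool
    sym   : ∀ u v → adj u v ≡ adj v u
    irrefl : ∀ u → adj u u ≡ false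

module _ (G : Graph) where
  open Graph G

  Adj : Fin n → Fin n → Set
  Adj u v = adj u v ≡ true

  data Walk : Fin n → Fin n → Set where
    here : ∀ {u} → Walk u u
    step : ∀ {u w v} → Adj u w → Walk w v → Walk u v

  Connected : Set
  Connected = ∀ u v → Walk u v

  CycNext : ∀ {k} → Fin k → Fin k → Set
  CycNext {k} i j = (suc (toℕ i) ≡ toℕ j) ⊎ ((suc (toℕ i) ≡ k) × (toℕ j ≡ 0))

  record LongCycle : Set where
    field
      m     : ℕ
      f     : Fin (m +ℕ 4) → Fin n
      f-inj : Injective _≡_ _≡_ f
      edges : ∀ i j → CycNext i j → Adj (f i) (f j)

  HasChord : LongCycle → Set
  HasChord C = ∃[ i ] ∃[ j ] (i ≢ j × ¬ CycNext i j × ¬ CycNext j i × Adj (f i) (f j))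
    where open LongCycle C

  Chordal : Set
  Chordal = (C : LongCycle) → HasChord C

  K4Free : Set
  K4Free = ¬ (Σ (Fin 4 → Fin n) λ g → ∀ i j → i ≢ j → Adj (g i) (g j))

  -- cliques: vertex subsets (as characteristic vectors) that are pairwise adjacent
  isCliqueᵇ : Vec Bool n → Bool
  isCliqueᵇ p = and (map (λ u → and (map (λ v →
      not (lookup p u ∧ lookup p v) ∨ does (u ≟ v) ∨ adj u v) (allFin n))) (allFin n))

  size : ∀ {k} → Vec Bool k → ℕ
  size [] = 0
  size (true ∷ p) = suc (size p)
  size (false ∷ p) = size p

  allSubsets : ∀ k → List (Vec Bool k)
  allSubsets zero = [] ∷ []
  allSubsets (suc k) = map (true ∷_) (allSubsets k) ++ map (false ∷_) (allSubsets k)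

  -- c_k(G): number of cliques with k vertices (c_0 = 1, the empty clique)
  cliqueCount : ℕ → ℕ
  cliqueCount k = length (filterᵇ (λ p → isCliqueᵇ p ∧ (size p ≡ᵇ k)) (allSubsets n))

  -- coefficient list [c_0 , c_1 , … , c_n] of the clique polynomial C(G,x)
  -- (coefficients c_k with k > ω(G) are 0, so this is C(G,x) with trailing zeros)
  cliqueCoeffs : List ℕ
  cliqueCoeffs = go (suc n) 0
    where
      go : ℕ → ℕ → List ℕ
      go zero _ = []
      go (suc r) k = cliqueCount k ∷ go r (suc k)

record RealField (c ℓ₁ ℓ₂ : Level) : Set (lsuc (c ⊔ ℓ₁ ⊔ ℓ₂)) where
  field
    commRing : CommutativeRing c ℓ₁
  open CommutativeRing commRing public
  field
    _≤_        : Carrier → Carrier → Set ℓ₂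
    isTotalOrder : IsTotalOrder _≈_ _≤_
    +-mono-≤   : ∀ {x y} z → x ≤ y → (x + z) ≤ (y + z)
    *-nonneg   : ∀ {x y} → 0# ≤ x → 0# ≤ y → 0# ≤ (x * y)
    0≉1        : ¬ (0# ≈ 1#)
    inverse    : ∀ x → ¬ (x ≈ 0#) → ∃[ y ] (x * y ≈ 1#)
    complete   : (P : Carrier → Set (c ⊔ ℓ₁ ⊔ ℓ₂)) → (∃[ x ] P x) →
                 (∃[ b ] (∀ x → P x → x ≤ b)) →
                 ∃[ s ] ((∀ x → P x → x ≤ s) × (∀ b → (∀ x → P x → x ≤ b) → s ≤ b))

module Complex {c ℓ₁ ℓ₂} (ℝ : RealField c ℓ₁ ℓ₂) where
  open RealField ℝ

  ℂ : Set c
  ℂ = Carrier × Carrier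

  _+ᶜ_ : ℂ → ℂ → ℂ
  (a , b) +ᶜ (a' , b') = (a + a') , (b + b')

  _*ᶜ_ : ℂ → ℂ → ℂ
  (a , b) *ᶜ (a' , b') = ((a * a') - (b * b')) , ((a * b') + (b * a'))

  fromℕ : ℕ → Carrier
  fromℕ zero = 0#
  fromℕ (suc k) = 1# + fromℕ k

  -- evaluation of the polynomial with coefficient list [a_0 , a_1 , …] (Horner)
  eval : List ℕ → ℂ → ℂ
  eval [] z = (0# , 0#)
  eval (a ∷ as) z = (fromℕ a , 0#) +ᶜ (z *ᶜ eval as z)

  IsRoot : List ℕ → ℂ → Set ℓ₁
  IsRoot p z = (proj₁ (eval p z) ≈ 0#) × (proj₂ (eval p z) ≈ 0#)

  OnlyRealRoots : List ℕ → Set (c ⊔ ℓ₁)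
  OnlyRealRoots p = ∀ z → IsRoot p z → proj₂ z ≈ 0#

OnlyCliqueRoots : ∀ {c ℓ₁ ℓ₂} → RealField c ℓ₁ ℓ₂ → Graph → Set (c ⊔ ℓ₁)
OnlyCliqueRoots ℝ G = Complex.OnlyRealRoots ℝ (cliqueCoeffs G)

{-# OPTIONS --safe #-}
module Submission where

-- Removing a simplicial vertex v of degree d removes exactly the cliques through v,
-- and these are v together with any subset of its neighbourhood, so
-- C(G, x) = C(G − v, x) + x (1 + x)^d. A connected chordal graph with at least two
-- vertices has a simplicial vertex (Dirac) whose removal keeps it connected, and
-- K₄-freeness gives 1 ≤ d ≤ 2. Induction then yields c₂ = (n − 1) + c₃ and either
-- c₃ = 0 or c₃ ≤ n − 2, so C(G, x) = (1 + x) (1 + (n − 1) x + c₃ x²) where the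
-- quadratic factor has discriminant (n − 1)² − 4 c₃ ≥ 0.

open import Level using (Level; Lift; lift; lower; _⊔_)
open import Data.Nat as ℕ using (ℕ; zero; suc)
import Data.Nat.Properties as ℕ
open import Data.Integer as ℤ using (ℤ; -[1+_])
import Data.Integer.Properties as ℤ
open import Data.Sign as Sign using (Sign)
open import Data.Product using (Σ; ∃; _×_; _,_; proj₁; proj₂)
open import Data.Sum using (_⊎_; inj₁; inj₂)
open import Data.Empty using (⊥; ⊥-elim)
open import Data.List as List using (List; []; _∷_; _++_; map; filterᵇ; allFin)
open import Data.List.Relation.Binary.Pointwise using (Pointwise; []; _∷_)
open import Data.Maybe using (Maybe; just; nothing)
open import Relation.Nullary using (¬_; yes; no; Dec; does; contradiction)
open import Relation.Binary.PropositionalEquality as ≡ using (_≡_; _≢_)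
open import Relation.Binary.Structures using (IsTotalOrder)
import Algebra.Solver.Ring.AlmostCommutativeRing as ACR
open import Defs

-- Real and complex arithmetic

module RealField-Properties {c ℓ₁ ℓ₂} (ℝ : RealField c ℓ₁ ℓ₂) where
  open RealField ℝ
  open Complex ℝ
  open IsTotalOrder isTotalOrder
    using (total; antisym; ≤-respˡ-≈; ≤-respʳ-≈)
    renaming (refl to ≤-refl; trans to ≤-trans; reflexive to ≤-reflexive)
  open import Algebra.Properties.Ring ring
    using (-‿distribˡ-*; -‿distribʳ-*; -‿involutive; -0#≈0#; -‿+-comm; -1*x≈-x)
  open import Algebra.Properties.CommutativeSemigroup *-commutativeSemigroup
    using () renaming (interchange to *-interchange)
  open import Relation.Binary.Reasoning.Setoid setoid

  fromℕ-+ : ∀ m n → fromℕ (m ℕ.+ n) ≈ fromℕ m + fromℕ n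
  fromℕ-+ zero    n = sym (+-identityˡ _)
  fromℕ-+ (suc m) n = trans (+-congˡ (fromℕ-+ m n)) (sym (+-assoc _ _ _))

  fromℕ-* : ∀ m n → fromℕ (m ℕ.* n) ≈ fromℕ m * fromℕ n
  fromℕ-* zero    n = sym (zeroˡ _)
  fromℕ-* (suc m) n = begin
    fromℕ (n ℕ.+ m ℕ.* n)              ≈⟨ fromℕ-+ n (m ℕ.* n) ⟩
    fromℕ n + fromℕ (m ℕ.* n)          ≈⟨ +-cong (sym (*-identityˡ _)) (fromℕ-* m n) ⟩
    1# * fromℕ n + fromℕ m * fromℕ n   ≈⟨ sym (distribʳ _ _ _) ⟩
    (1# + fromℕ m) * fromℕ n           ∎

  ⟦_⟧ℤ : ℤ → Carrier
  ⟦ ℤ.+ n    ⟧ℤ = fromℕ n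
  ⟦ -[1+ n ] ⟧ℤ = - fromℕ (suc n)

  ⟦⟧ℤ-neg : ∀ i → ⟦ ℤ.- i ⟧ℤ ≈ - ⟦ i ⟧ℤ
  ⟦⟧ℤ-neg -[1+ n ]     = sym (-‿involutive _)
  ⟦⟧ℤ-neg (ℤ.+ zero)    = sym -0#≈0#
  ⟦⟧ℤ-neg (ℤ.+ suc n)   = refl

  ⟦⟧ℤ-⊖ : ∀ m n → ⟦ m ℤ.⊖ n ⟧ℤ ≈ fromℕ m - fromℕ n
  ⟦⟧ℤ-⊖ zero    zero    = sym (-‿inverseʳ 0#)
  ⟦⟧ℤ-⊖ zero    (suc n) = sym (+-identityˡ _)
  ⟦⟧ℤ-⊖ (suc m) zero    = trans (sym (+-identityʳ _)) (+-congˡ (sym -0#≈0#))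
  ⟦⟧ℤ-⊖ (suc m) (suc n) = begin
    ⟦ suc m ℤ.⊖ suc n ⟧ℤ                    ≡⟨ ≡.cong ⟦_⟧ℤ (ℤ.[1+m]⊖[1+n]≡m⊖n m n) ⟩
    ⟦ m ℤ.⊖ n ⟧ℤ                            ≈⟨ ⟦⟧ℤ-⊖ m n ⟩
    fromℕ m - fromℕ n                       ≈⟨ sym (+-identityˡ _) ⟩
    0# + (fromℕ m - fromℕ n)                ≈⟨ +-congʳ (sym (-‿inverseʳ 1#)) ⟩
    (1# - 1#) + (fromℕ m - fromℕ n)         ≈⟨ +-assoc _ _ _ ⟩
    1# + (- 1# + (fromℕ m - fromℕ n))       ≈⟨ +-congˡ (sym (+-assoc _ _ _)) ⟩
    1# + ((- 1# + fromℕ m) - fromℕ n)       ≈⟨ +-congˡ (+-congʳ (+-comm _ _)) ⟩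
    1# + ((fromℕ m - 1#) - fromℕ n)         ≈⟨ +-congˡ (+-assoc _ _ _) ⟩
    1# + (fromℕ m + (- 1# - fromℕ n))       ≈⟨ +-congˡ (+-congˡ (-‿+-comm _ _)) ⟩
    1# + (fromℕ m - (1# + fromℕ n))         ≈⟨ sym (+-assoc _ _ _) ⟩
    (1# + fromℕ m) - (1# + fromℕ n)         ∎

  ⟦⟧ℤ-+ : ∀ i j → ⟦ i ℤ.+ j ⟧ℤ ≈ ⟦ i ⟧ℤ + ⟦ j ⟧ℤ
  ⟦⟧ℤ-+ -[1+ m ] -[1+ n ] = begin
    - fromℕ (suc (suc (m ℕ.+ n)))        ≡⟨ ≡.cong (λ k → - fromℕ (suc k)) (≡.sym (ℕ.+-suc m n)) ⟩
    - fromℕ (suc m ℕ.+ suc n)            ≈⟨ -‿cong (fromℕ-+ (suc m) (suc n)) ⟩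
    - (fromℕ (suc m) + fromℕ (suc n))    ≈⟨ sym (-‿+-comm _ _) ⟩
    - fromℕ (suc m) + - fromℕ (suc n)    ∎
  ⟦⟧ℤ-+ -[1+ m ] (ℤ.+ n)  = trans (⟦⟧ℤ-⊖ n (suc m)) (+-comm _ _)
  ⟦⟧ℤ-+ (ℤ.+ m)  -[1+ n ] = ⟦⟧ℤ-⊖ m (suc n)
  ⟦⟧ℤ-+ (ℤ.+ m)  (ℤ.+ n)  = fromℕ-+ m n

  ⟦_⟧± : Sign → Carrier
  ⟦ Sign.+ ⟧± = 1#
  ⟦ Sign.- ⟧± = - 1#

  ⟦⟧±-* : ∀ s t → ⟦ s Sign.* t ⟧± ≈ ⟦ s ⟧± * ⟦ t ⟧±
  ⟦⟧±-* Sign.+ t      = sym (*-identityˡ _)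
  ⟦⟧±-* Sign.- Sign.+ = sym (*-identityʳ _)
  ⟦⟧±-* Sign.- Sign.- = sym (trans (-1*x≈-x (- 1#)) (-‿involutive 1#))

  ⟦⟧ℤ-◃ : ∀ s n → ⟦ s ℤ.◃ n ⟧ℤ ≈ ⟦ s ⟧± * fromℕ n
  ⟦⟧ℤ-◃ s      zero    = sym (zeroʳ _)
  ⟦⟧ℤ-◃ Sign.+ (suc n) = sym (*-identityˡ _)
  ⟦⟧ℤ-◃ Sign.- (suc n) = sym (-1*x≈-x _)

  ⟦⟧ℤ-sign-abs : ∀ i → ⟦ i ⟧ℤ ≈ ⟦ ℤ.sign i ⟧± * fromℕ ℤ.∣ i ∣
  ⟦⟧ℤ-sign-abs (ℤ.+ n)  = sym (*-identityˡ _)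
  ⟦⟧ℤ-sign-abs -[1+ n ] = sym (-1*x≈-x _)

  ⟦⟧ℤ-* : ∀ i j → ⟦ i ℤ.* j ⟧ℤ ≈ ⟦ i ⟧ℤ * ⟦ j ⟧ℤ
  ⟦⟧ℤ-* i j = begin
    ⟦ i ℤ.* j ⟧ℤ                                        ≈⟨ ⟦⟧ℤ-◃ (s Sign.* t) (ℤ.∣ i ∣ ℕ.* ℤ.∣ j ∣) ⟩
    ⟦ s Sign.* t ⟧± * fromℕ (ℤ.∣ i ∣ ℕ.* ℤ.∣ j ∣)        ≈⟨ *-cong (⟦⟧±-* s t) (fromℕ-* ℤ.∣ i ∣ ℤ.∣ j ∣) ⟩
    (⟦ s ⟧± * ⟦ t ⟧±) * (fromℕ ℤ.∣ i ∣ * fromℕ ℤ.∣ j ∣)  ≈⟨ *-interchange _ _ _ _ ⟩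
    (⟦ s ⟧± * fromℕ ℤ.∣ i ∣) * (⟦ t ⟧± * fromℕ ℤ.∣ j ∣)  ≈⟨ sym (*-cong (⟦⟧ℤ-sign-abs i) (⟦⟧ℤ-sign-abs j)) ⟩
    ⟦ i ⟧ℤ * ⟦ j ⟧ℤ                                      ∎
    where s = ℤ.sign i; t = ℤ.sign j

  -- The ring solver needs a coefficient ring with decidable equality mapped into ℝ.
  ℤ⟶ℝ : ℤ.+-*-rawRing ACR.-Raw-AlmostCommutative⟶ ACR.fromCommutativeRing commRing
  ℤ⟶ℝ = record
    { ⟦_⟧ = ⟦_⟧ℤ ; +-homo = ⟦⟧ℤ-+ ; *-homo = ⟦⟧ℤ-* ; -‿homo = ⟦⟧ℤ-neg
    ; 0-homo = refl ; 1-homo = +-identityʳ _ }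

  ⟦⟧ℤ-≟ : ∀ i j → Maybe (⟦ i ⟧ℤ ≈ ⟦ j ⟧ℤ)
  ⟦⟧ℤ-≟ i j with i ℤ.≟ j
  ... | yes ≡.refl = just refl
  ... | no _       = nothing

  open import Algebra.Solver.Ring ℤ.+-*-rawRing (ACR.fromCommutativeRing commRing) ℤ⟶ℝ ⟦⟧ℤ-≟
    using (solve; _:+_; _:*_; _:-_; _:=_; con; Polynomial)

  κ : ∀ {k} → ℕ → Polynomial k
  κ m = con (ℤ.+ m)

  ≤-resp-≈ : ∀ {x x' y y'} → x ≈ x' → y ≈ y' → x ≤ y → x' ≤ y'
  ≤-resp-≈ p q h = ≤-respʳ-≈ q (≤-respˡ-≈ p h)

  x≤0⇒0≤-x : ∀ {x} → x ≤ 0# → 0# ≤ (- x)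
  x≤0⇒0≤-x {x} h = ≤-resp-≈ (-‿inverseʳ x) (+-identityˡ _) (+-mono-≤ (- x) h)

  -x*-x≈x*x : ∀ x → - x * - x ≈ x * x
  -x*-x≈x*x x = begin
    - x * - x      ≈⟨ sym (-‿distribˡ-* _ _) ⟩
    - (x * - x)    ≈⟨ -‿cong (sym (-‿distribʳ-* _ _)) ⟩
    - - (x * x)    ≈⟨ -‿involutive _ ⟩
    x * x          ∎

  0≤x*x : ∀ x → 0# ≤ (x * x)
  0≤x*x x with total 0# x
  ... | inj₁ 0≤x = *-nonneg 0≤x 0≤x
  ... | inj₂ x≤0 = ≤-resp-≈ refl (-x*-x≈x*x x) (*-nonneg (x≤0⇒0≤-x x≤0) (x≤0⇒0≤-x x≤0))

  0≤1 : 0# ≤ 1#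
  0≤1 = ≤-resp-≈ refl (*-identityˡ 1#) (0≤x*x 1#)

  1≰0 : ¬ (1# ≤ 0#)
  1≰0 h = 0≉1 (antisym 0≤1 h)

  +-mono-≤₂ : ∀ {x y u v} → x ≤ y → u ≤ v → (x + u) ≤ (y + v)
  +-mono-≤₂ {y = y} {u} p q =
    ≤-trans (+-mono-≤ u p) (≤-resp-≈ (+-comm _ _) (+-comm _ _) (+-mono-≤ y q))

  +-nonneg : ∀ {x y} → 0# ≤ x → 0# ≤ y → 0# ≤ (x + y)
  +-nonneg p q = ≤-resp-≈ (+-identityˡ 0#) refl (+-mono-≤₂ p q)

  +-nonpos : ∀ {x y} → x ≤ 0# → y ≤ 0# → (x + y) ≤ 0#
  +-nonpos p q = ≤-resp-≈ refl (+-identityˡ 0#) (+-mono-≤₂ p q)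

  nonneg-+≈0⇒≈0 : ∀ {x y} → 0# ≤ x → 0# ≤ y → x + y ≈ 0# → x ≈ 0#
  nonneg-+≈0⇒≈0 {x} p q e = antisym (≤-resp-≈ (+-identityʳ x) e (+-mono-≤₂ (≤-refl {x}) q)) p

  0≤fromℕ : ∀ k → 0# ≤ fromℕ k
  0≤fromℕ zero    = ≤-refl
  0≤fromℕ (suc k) = +-nonneg 0≤1 (0≤fromℕ k)

  fromℕ-mono-≤ : ∀ {i j} → i ℕ.≤ j → fromℕ i ≤ fromℕ j
  fromℕ-mono-≤ {i} i≤j with ℕ.m≤n⇒∃[o]m+o≡n i≤j
  ... | d , ≡.refl =
    ≤-resp-≈ (+-identityʳ _) (sym (fromℕ-+ i d)) (+-mono-≤₂ (≤-refl {fromℕ i}) (0≤fromℕ d))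

  fromℕ-suc≉0 : ∀ k → ¬ (fromℕ (suc k) ≈ 0#)
  fromℕ-suc≉0 k e = 1≰0 (≤-resp-≈ (+-identityʳ 1#) e (+-mono-≤₂ (≤-refl {1#}) (0≤fromℕ k)))

  *-cancelˡ-≈0 : ∀ {c x} → ¬ (c ≈ 0#) → c * x ≈ 0# → x ≈ 0#
  *-cancelˡ-≈0 {c} {x} c≉0 e with inverse c c≉0
  ... | y , cy≈1 = begin
    x              ≈⟨ sym (*-identityˡ x) ⟩
    1# * x         ≈⟨ *-congʳ (trans (sym cy≈1) (*-comm c y)) ⟩
    (y * c) * x    ≈⟨ *-assoc _ _ _ ⟩
    y * (c * x)    ≈⟨ *-congˡ e ⟩
    y * 0#         ≈⟨ zeroʳ y ⟩
    0#             ∎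

  *-≉0 : ∀ {x y} → ¬ (x ≈ 0#) → ¬ (y ≈ 0#) → ¬ (x * y ≈ 0#)
  *-≉0 x≉0 y≉0 e = y≉0 (*-cancelˡ-≈0 x≉0 e)

  x*x≉0 : ∀ {x} → ¬ (x ≈ 0#) → ¬ (x * x ≈ 0#)
  x*x≉0 x≉0 = *-≉0 x≉0 x≉0

  Positive : Carrier → Set ℓ₂
  Positive ε = ¬ (ε ≤ 0#)

  half : Σ Carrier λ h → fromℕ 2 * h ≈ 1#
  half = inverse (fromℕ 2) (fromℕ-suc≉0 1)

  halves : ∀ ε → ε * proj₁ half + ε * proj₁ half ≈ ε
  halves ε = begin
    ε * h + ε * h                                  ≈⟨ +-congˡ (sym (+-identityʳ _)) ⟩
    ε * h + (ε * h + 0#)                           ≈⟨ sym (+-cong (*-identityˡ _) (+-cong (*-identityˡ _) (zeroˡ _))) ⟩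
    1# * (ε * h) + (1# * (ε * h) + 0# * (ε * h))   ≈⟨ sym (trans (distribʳ _ _ _) (+-congˡ (distribʳ _ _ _))) ⟩
    fromℕ 2 * (ε * h)                              ≈⟨ *-congˡ (*-comm _ _) ⟩
    fromℕ 2 * (h * ε)                              ≈⟨ sym (*-assoc _ _ _) ⟩
    (fromℕ 2 * h) * ε                              ≈⟨ *-congʳ (proj₂ half) ⟩
    1# * ε                                         ≈⟨ *-identityˡ ε ⟩
    ε                                              ∎
    where h = proj₁ half

  half-positive : ∀ {ε} → Positive ε → Positive (ε * proj₁ half)
  half-positive {ε} ε>0 h≤0 = ε>0 (≤-resp-≈ (halves ε) refl (+-nonpos h≤0 h≤0))

  -- The least upper bound s of {w | w ≤ ε for every positive ε} satisfies
  -- s + s ≤ s, hence s ≤ 0#; and d belongs to that set unless d ≤ 0# fails.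
  ≤0-stable : ∀ {d} → ¬ ¬ (d ≤ 0#) → d ≤ 0#
  ≤0-stable {d} ¬¬d≤0 = ≤-trans (isUpper d d∈Below) s≤0
    where
    Below : Carrier → Set (c ⊔ ℓ₁ ⊔ ℓ₂)
    Below w = Lift (c ⊔ ℓ₁ ⊔ ℓ₂) (∀ ε → Positive ε → w ≤ ε)

    d∈Below : Below d
    d∈Below = lift λ ε ε>0 → case (total d ε) ε>0
      where
      case : ∀ {ε} → (d ≤ ε) ⊎ (ε ≤ d) → Positive ε → d ≤ ε
      case (inj₁ d≤ε) _   = d≤ε
      case (inj₂ ε≤d) ε>0 = ⊥-elim (¬¬d≤0 λ d≤0 → ε>0 (≤-trans ε≤d d≤0))

    sup = complete Below (d , d∈Below) (1# , λ x x∈Below → lower x∈Below 1# 1≰0)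
    s = proj₁ sup
    isUpper = proj₁ (proj₂ sup)
    isLeast = proj₂ (proj₂ sup)

    s≤ε : ∀ ε → Positive ε → s ≤ ε
    s≤ε ε ε>0 = isLeast ε (λ x x∈Below → lower x∈Below ε ε>0)

    s+s≤s : (s + s) ≤ s
    s+s≤s = isUpper (s + s) (lift λ ε ε>0 →
      ≤-resp-≈ refl (halves ε) (+-mono-≤₂ (s≤ε _ (half-positive ε>0)) (s≤ε _ (half-positive ε>0))))

    s≤0 : s ≤ 0#
    s≤0 = ≤-resp-≈ s+s-s≈s (-‿inverseʳ s) (+-mono-≤ (- s) s+s≤s)
      where
      s+s-s≈s : s + s - s ≈ s
      s+s-s≈s = trans (+-assoc _ _ _) (trans (+-congˡ (-‿inverseʳ s)) (+-identityʳ s))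

  ≈0-stable : ∀ {x} → ¬ ¬ (x ≈ 0#) → x ≈ 0#
  ≈0-stable {x} ¬¬x≈0 = antisym x≤0 0≤x
    where
    x≤0 : x ≤ 0#
    x≤0 = ≤0-stable λ x≰0 → ¬¬x≈0 λ x≈0 → x≰0 (≤-reflexive x≈0)
    0≤x : 0# ≤ x
    0≤x = ≤-resp-≈ refl (-‿involutive x) (x≤0⇒0≤-x (≤0-stable λ -x≰0 →
      ¬¬x≈0 λ x≈0 → -x≰0 (≤-reflexive (trans (-‿cong x≈0) -0#≈0#))))

  infix 4 _≈ᶜ_
  _≈ᶜ_ : ℂ → ℂ → Set ℓ₁
  (a , b) ≈ᶜ (a' , b') = (a ≈ a') × (b ≈ b')

  ≈ᶜ-refl : ∀ {z} → z ≈ᶜ z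
  ≈ᶜ-refl = refl , refl

  ≈ᶜ-sym : ∀ {z w} → z ≈ᶜ w → w ≈ᶜ z
  ≈ᶜ-sym (re , im) = sym re , sym im

  ≈ᶜ-trans : ∀ {z w u} → z ≈ᶜ w → w ≈ᶜ u → z ≈ᶜ u
  ≈ᶜ-trans (re , im) (re′ , im′) = trans re re′ , trans im im′

  evalℝ : List Carrier → ℂ → ℂ
  evalℝ []       z = (0# , 0#)
  evalℝ (a ∷ as) z = (a , 0#) +ᶜ (z *ᶜ evalℝ as z)

  evalℝ-cong : ∀ {xs ys} → Pointwise _≈_ xs ys → ∀ z → evalℝ xs z ≈ᶜ evalℝ ys z
  evalℝ-cong []            z = refl , refl
  evalℝ-cong (x≈y ∷ xs≈ys) z with evalℝ-cong xs≈ys z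
  ... | re , im = +-cong x≈y (+-cong (*-congˡ re) (-‿cong (*-congˡ im)))
                , +-congˡ (+-cong (*-congˡ im) (*-congˡ re))

  private
    ℂ[_] : ℕ → Set
    ℂ[ k ] = Polynomial k × Polynomial k

    _*ᴾ_ : ∀ {k} → ℂ[ k ] → ℂ[ k ] → ℂ[ k ]
    (a , b) *ᴾ (a' , b') = ((a :* a') :- (b :* b')) , ((a :* b') :+ (b :* a'))

    evalᴾ : ∀ {k} → List (Polynomial k) → ℂ[ k ] → ℂ[ k ]
    evalᴾ []       z = κ 0 , κ 0
    evalᴾ (a ∷ as) z = (a , κ 0) +ᴾ (z *ᴾ evalᴾ as z)
      where
      _+ᴾ_ : ∀ {k} → ℂ[ k ] → ℂ[ k ] → ℂ[ k ]
      (a , b) +ᴾ (a' , b') = (a :+ a') , (b :+ b')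

  quadRe quadIm : Carrier → Carrier → Carrier → Carrier → Carrier
  quadRe M T a b = fromℕ 1 + M * a + T * (a * a - b * b)
  quadIm M T a b = M + fromℕ 2 * T * a

  -- 1 + (1 + M) z + (M + T) z² + T z³ = (1 + z) (1 + M z + T z²), with z = a + b i
  cubic-factorisation : ∀ M T a b →
    evalℝ (fromℕ 1 ∷ fromℕ 1 + M ∷ M + T ∷ T ∷ []) (a , b)
      ≈ᶜ (fromℕ 1 + a , b) *ᶜ (quadRe M T a b , b * quadIm M T a b)
  cubic-factorisation =
    λ M T a b → solve 4 (λ M T a b → proj₁ (lhs M T a b) := proj₁ (rhs M T a b)) refl M T a b
              , solve 4 (λ M T a b → proj₂ (lhs M T a b) := proj₂ (rhs M T a b)) refl M T a b
    where
    lhs rhs : ∀ {k} → Polynomial k → Polynomial k → Polynomial k → Polynomial k → ℂ[ k ]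
    lhs M T a b = evalᴾ (κ 1 ∷ κ 1 :+ M ∷ M :+ T ∷ T ∷ []) (a , b)
    rhs M T a b = (κ 1 :+ a , b)
      *ᴾ ( κ 1 :+ M :* a :+ T :* (a :* a :- b :* b)
         , b :* (M :+ κ 2 :* T :* a))

  x≈0⇒y*x≈0 : ∀ {x} y → x ≈ 0# → y * x ≈ 0#
  x≈0⇒y*x≈0 y x≈0 = trans (*-congˡ x≈0) (zeroʳ y)

  ≈0-+ : ∀ {x y} → x ≈ 0# → y ≈ 0# → x + y ≈ 0#
  ≈0-+ x≈0 y≈0 = trans (+-cong x≈0 y≈0) (+-identityʳ 0#)

  ≈0-- : ∀ {x y} → x ≈ 0# → y ≈ 0# → x - y ≈ 0#
  ≈0-- x≈0 y≈0 = ≈0-+ x≈0 (trans (-‿cong y≈0) -0#≈0#)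

  *ᶜ-cancelˡ : ∀ p q r s → ¬ (p * p + q * q ≈ 0#) →
               (p , q) *ᶜ (r , s) ≈ᶜ (0# , 0#) → (r ≈ 0#) × (s ≈ 0#)
  *ᶜ-cancelˡ p q r s N≉0 (re≈0 , im≈0) =
      *-cancelˡ-≈0 N≉0 (trans (sym (conj-re p q r s)) (≈0-+ (x≈0⇒y*x≈0 p re≈0) (x≈0⇒y*x≈0 q im≈0)))
    , *-cancelˡ-≈0 N≉0 (trans (sym (conj-im p q r s)) (≈0-- (x≈0⇒y*x≈0 p im≈0) (x≈0⇒y*x≈0 q re≈0)))
    where
    conj-re : ∀ p q r s → p * (p * r - q * s) + q * (p * s + q * r) ≈ (p * p + q * q) * r
    conj-re = solve 4 (λ p q r s → p :* (p :* r :- q :* s) :+ q :* (p :* s :+ q :* r)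
                                    := (p :* p :+ q :* q) :* r) refl
    conj-im : ∀ p q r s → p * (p * s + q * r) - q * (p * r - q * s) ≈ (p * p + q * q) * s
    conj-im = solve 4 (λ p q r s → p :* (p :* s :+ q :* r) :- q :* (p :* r :- q :* s)
                                    := (p :* p :+ q :* q) :* s) refl

  -- A non-real root of 1 + M z + T z² forces M = -2Ta and then M² - 4T = -(2Tb)² < 0.
  quadratic-factor-≉0 : ∀ m t → 4 ℕ.* t ℕ.≤ m ℕ.* m → ∀ a b → ¬ (b ≈ 0#) →
    ¬ ((quadRe (fromℕ m) (fromℕ t) a b ≈ 0#) × (b * quadIm (fromℕ m) (fromℕ t) a b ≈ 0#))
  quadratic-factor-≉0 m zero _ a b b≉0 (re≈0 , b*im≈0) =
    fromℕ-suc≉0 0 (trans (sym 1+Ma≈1) (trans (sym (re-at-0 M a b)) re≈0))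
    where
    M = fromℕ m
    im-at-0 : ∀ M a b → quadIm M 0# a b ≈ M
    im-at-0 = solve 3 (λ M a b → M :+ κ 2 :* κ 0 :* a := M) refl
    re-at-0 : ∀ M a b → quadRe M 0# a b ≈ fromℕ 1 + M * a
    re-at-0 = solve 3 (λ M a b → κ 1 :+ M :* a :+ κ 0 :* (a :* a :- b :* b)
                                  := κ 1 :+ M :* a) refl
    M≈0 : M ≈ 0#
    M≈0 = trans (sym (im-at-0 M a b)) (*-cancelˡ-≈0 b≉0 b*im≈0)
    1+Ma≈1 : fromℕ 1 + M * a ≈ fromℕ 1
    1+Ma≈1 = trans (+-congˡ (trans (*-congʳ M≈0) (zeroˡ a))) (+-identityʳ _)
  quadratic-factor-≉0 m t@(suc t') 4t≤m² a b b≉0 (re≈0 , b*im≈0) =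
    x*x≉0 2Tb≉0 (nonneg-+≈0⇒≈0 (0≤x*x 2Tb) 0≤disc sum≈0)
    where
    M = fromℕ m
    T = fromℕ t
    2Tb = fromℕ 2 * T * b
    2Tb≉0 : ¬ (2Tb ≈ 0#)
    2Tb≉0 = *-≉0 (*-≉0 (fromℕ-suc≉0 1) (fromℕ-suc≉0 t')) b≉0
    discriminant : ∀ M T a b → (fromℕ 2 * T * b) * (fromℕ 2 * T * b) + (M * M - fromℕ 4 * T)
                               ≈ quadIm M T a b * quadIm M T a b - fromℕ 4 * T * quadRe M T a b
    discriminant = solve 4 (λ M T a b →
      (κ 2 :* T :* b) :* (κ 2 :* T :* b) :+ (M :* M :- κ 4 :* T)
        := (M :+ κ 2 :* T :* a) :* (M :+ κ 2 :* T :* a)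
           :- κ 4 :* T :* (κ 1 :+ M :* a :+ T :* (a :* a :- b :* b))) refl
    0≤disc : 0# ≤ (M * M - fromℕ 4 * T)
    0≤disc = ≤-resp-≈ (-‿inverseʳ _) refl
      (+-mono-≤ (- (fromℕ 4 * T)) (≤-resp-≈ (fromℕ-* 4 t) (fromℕ-* m m) (fromℕ-mono-≤ 4t≤m²)))
    sum≈0 : 2Tb * 2Tb + (M * M - fromℕ 4 * T) ≈ 0#
    sum≈0 = trans (discriminant M T a b)
      (≈0-- (x≈0⇒y*x≈0 _ (*-cancelˡ-≈0 b≉0 b*im≈0)) (x≈0⇒y*x≈0 _ re≈0))

  -- A root with b ≉ 0 makes 1 + z nonzero, so it is a root of the quadratic factor.
  cubic-onlyRealRoots : ∀ m t → 4 ℕ.* t ℕ.≤ m ℕ.* m → OnlyRealRoots (1 ∷ suc m ∷ m ℕ.+ t ∷ t ∷ [])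
  cubic-onlyRealRoots m t 4t≤m² (a , b) (re≈0 , im≈0) = ≈0-stable λ b≉0 →
    quadratic-factor-≉0 m t 4t≤m² a b b≉0
      (*ᶜ-cancelˡ (fromℕ 1 + a) b (quadRe M T a b) (b * quadIm M T a b) (norm≉0 b≉0)
        (trans (sym (proj₁ factor)) re≈0 , trans (sym (proj₂ factor)) im≈0))
    where
    M = fromℕ m
    T = fromℕ t
    coefficients : Pointwise _≈_ (fromℕ 1 ∷ fromℕ (suc m) ∷ fromℕ (m ℕ.+ t) ∷ T ∷ [])
                                 (fromℕ 1 ∷ fromℕ 1 + M ∷ M + T ∷ T ∷ [])
    coefficients = refl ∷ fromℕ-+ 1 m ∷ fromℕ-+ m t ∷ refl ∷ []
    factor : eval (1 ∷ suc m ∷ m ℕ.+ t ∷ t ∷ []) (a , b)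
               ≈ᶜ (fromℕ 1 + a , b) *ᶜ (quadRe M T a b , b * quadIm M T a b)
    factor = ≈ᶜ-trans (evalℝ-cong coefficients (a , b)) (cubic-factorisation M T a b)
    norm≉0 : ¬ (b ≈ 0#) → ¬ ((fromℕ 1 + a) * (fromℕ 1 + a) + b * b ≈ 0#)
    norm≉0 b≉0 N≈0 = x*x≉0 b≉0 (nonneg-+≈0⇒≈0 (0≤x*x b) (0≤x*x _) (trans (+-comm _ _) N≈0))

  1-noRoot : ∀ z → ¬ IsRoot (1 ∷ []) z
  1-noRoot (a , b) (re≈0 , _) = fromℕ-suc≉0 0
    (trans (sym (+-identityʳ _)) (trans (+-congˡ (sym (≈0-- (zeroʳ a) (zeroʳ b)))) re≈0))

  eval-++-0 : ∀ xs z → eval (xs ++ 0 ∷ []) z ≈ᶜ eval xs z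
  eval-++-0 []       (a , b) = ≈0-+ refl (≈0-- (zeroʳ a) (zeroʳ b)) , ≈0-+ refl (≈0-+ (zeroʳ a) (zeroʳ b))
  eval-++-0 (x ∷ xs) z@(a , b) with eval-++-0 xs z
  ... | re , im = +-congˡ (+-cong (*-congˡ re) (-‿cong (*-congˡ im)))
                , +-congˡ (+-cong (*-congˡ im) (*-congˡ re))

  IsRoot-resp : ∀ xs ys {z} → eval xs z ≈ᶜ eval ys z → IsRoot xs z → IsRoot ys z
  IsRoot-resp _ _ (re , im) (re≈0 , im≈0) = trans (sym re) re≈0 , trans (sym im) im≈0

-- Opened only now: these names would clash with the fields of RealField above.
open import Data.Nat using (_+_; _*_; _∸_; _≤_; _<_; _≤′_; ≤′-refl; ≤′-step; z≤n; s≤s; _≤?_; _≡ᵇ_)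
open import Data.Nat.Induction using (<-rec)
open import Data.Nat.Tactic.RingSolver using (solve-∀)
open import Algebra.Properties.CommutativeSemigroup ℕ.+-commutativeSemigroup
  using () renaming (interchange to +-interchange)
open import Data.Bool as Bool using (Bool; true; false; _∧_; _∨_; not; T)
open import Data.Bool.Properties using (∧-zeroʳ; ∧-assoc; ∧-conicalˡ; ∧-conicalʳ; T-≡; ⇔→≡)
open import Data.Bool.ListAction using (all)
open import Data.Fin as Fin using (Fin; zero; suc; toℕ; _≟_)
import Data.Fin.Properties as Fin
open import Data.Vec using (Vec; []; _∷_; lookup; tabulate; replicate; _[_]≔_)
import Data.Vec.Properties as Vec
open import Data.List.Membership.Propositional.Properties using (∈-allFin)
import Data.List.Relation.Unary.All as All
open import Data.List.Relation.Unary.All.Properties using (all⁺; all⁻)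
open import Function using (_∘_; _∘′_; Injective; _⇔_; Equivalence; mk⇔)
open import Relation.Nullary.Decidable using (decidable-stable; _⊎-dec_; ¬¬-excluded-middle)
open import Relation.Nullary.Negation using (¬¬-Monad; ¬¬-map)
open import Effect.Monad using (RawMonad)
open import Relation.Binary.PropositionalEquality
open import Relation.Binary.Definitions using (tri<; tri≈; tri>)

open RawMonad (¬¬-Monad {Level.zero}) using (pure; _>>=_)

-- Counting subsets and cliques

boolToℕ : Bool → ℕ
boolToℕ true  = 1
boolToℕ false = 0

module _ {A : Set} where

  count : (A → Bool) → List A → ℕ
  count p xs = List.length (filterᵇ p xs)

  count-∷ : ∀ p x xs → count p (x ∷ xs) ≡ boolToℕ (p x) + count p xs
  count-∷ p x xs with p x
  ... | true  = refl
  ... | false = refl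

  count-cong : ∀ {p q} → (∀ x → p x ≡ q x) → ∀ xs → count p xs ≡ count q xs
  count-cong p≗q []       = refl
  count-cong {p} {q} p≗q (x ∷ xs) = begin
    count p (x ∷ xs)                ≡⟨ count-∷ p x xs ⟩
    boolToℕ (p x) + count p xs      ≡⟨ cong₂ _+_ (cong boolToℕ (p≗q x)) (count-cong p≗q xs) ⟩
    boolToℕ (q x) + count q xs      ≡⟨ count-∷ q x xs ⟨
    count q (x ∷ xs)                ∎
    where open ≡-Reasoning

  count-none : ∀ {p} → (∀ x → p x ≡ false) → ∀ xs → count p xs ≡ 0
  count-none p≗false []       = refl
  count-none {p} p≗false (x ∷ xs) =
    trans (count-∷ p x xs) (cong₂ _+_ (cong boolToℕ (p≗false x)) (count-none p≗false xs))

  count-++ : ∀ p xs ys → count p (xs ++ ys) ≡ count p xs + count p ys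
  count-++ p []       ys = refl
  count-++ p (x ∷ xs) ys = begin
    count p (x ∷ xs ++ ys)                         ≡⟨ count-∷ p x (xs ++ ys) ⟩
    boolToℕ (p x) + count p (xs ++ ys)             ≡⟨ cong (boolToℕ (p x) +_) (count-++ p xs ys) ⟩
    boolToℕ (p x) + (count p xs + count p ys)      ≡⟨ ℕ.+-assoc (boolToℕ (p x)) _ _ ⟨
    (boolToℕ (p x) + count p xs) + count p ys      ≡⟨ cong (_+ count p ys) (count-∷ p x xs) ⟨
    count p (x ∷ xs) + count p ys                  ∎
    where open ≡-Reasoning

  count-split : ∀ {p q r} → (∀ x → boolToℕ (p x) ≡ boolToℕ (q x) + boolToℕ (r x)) →
                ∀ xs → count p xs ≡ count q xs + count r xs
  count-split split []       = refl
  count-split {p} {q} {r} split (x ∷ xs) = begin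
    count p (x ∷ xs)                                       ≡⟨ count-∷ p x xs ⟩
    boolToℕ (p x) + count p xs                             ≡⟨ cong₂ _+_ (split x) (count-split split xs) ⟩
    (boolToℕ (q x) + boolToℕ (r x)) + (count q xs + count r xs) ≡⟨ +-interchange (boolToℕ (q x)) _ _ _ ⟩
    (boolToℕ (q x) + count q xs) + (boolToℕ (r x) + count r xs) ≡⟨ cong₂ _+_ (count-∷ q x xs) (count-∷ r x xs) ⟨
    count q (x ∷ xs) + count r (x ∷ xs)                    ∎
    where open ≡-Reasoning

count-map : ∀ {A B : Set} (p : B → Bool) (f : A → B) xs → count p (map f xs) ≡ count (λ x → p (f x)) xs
count-map p f []       = refl
count-map p f (x ∷ xs) =
  trans (count-∷ p (f x) (map f xs)) (trans (cong (boolToℕ (p (f x)) +_) (count-map p f xs)) (sym (count-∷ _ x xs)))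

infix 4 _∈ᵥ_ _⊆ᵥ_
infix 7 _⊆ᵇ_
infixl 8 _-ᵥ_

_∈ᵥ_ : ∀ {k} → Fin k → Vec Bool k → Set
x ∈ᵥ U = lookup U x ≡ true

_⊆ᵥ_ : ∀ {k} → Vec Bool k → Vec Bool k → Set
P ⊆ᵥ Q = ∀ {x} → x ∈ᵥ P → x ∈ᵥ Q

_⊆ᵇ_ : ∀ {k} → Vec Bool k → Vec Bool k → Bool
[]      ⊆ᵇ []      = true
(x ∷ p) ⊆ᵇ (y ∷ q) = (not x ∨ y) ∧ (p ⊆ᵇ q)

_-ᵥ_ : ∀ {k} → Vec Bool k → Fin k → Vec Bool k
U -ᵥ v = U [ v ]≔ false

⊆ᵇ⇒⊆ᵥ : ∀ {k} (p q : Vec Bool k) → p ⊆ᵇ q ≡ true → p ⊆ᵥ q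
⊆ᵇ⇒⊆ᵥ (true  ∷ p) (true  ∷ q) p⊆q {zero}  _   = refl
⊆ᵇ⇒⊆ᵥ (true  ∷ p) (true  ∷ q) p⊆q {suc x} x∈p = ⊆ᵇ⇒⊆ᵥ p q p⊆q x∈p
⊆ᵇ⇒⊆ᵥ (false ∷ p) (y     ∷ q) p⊆q {suc x} x∈p = ⊆ᵇ⇒⊆ᵥ p q p⊆q x∈p

⊆ᵥ⇒⊆ᵇ : ∀ {k} (p q : Vec Bool k) → p ⊆ᵥ q → p ⊆ᵇ q ≡ true
⊆ᵥ⇒⊆ᵇ []          []          _   = refl
⊆ᵥ⇒⊆ᵇ (true  ∷ p) (true  ∷ q) p⊆q = ⊆ᵥ⇒⊆ᵇ p q (λ {x} → p⊆q {suc x})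
⊆ᵥ⇒⊆ᵇ (true  ∷ p) (false ∷ q) p⊆q with () ← p⊆q {zero} refl
⊆ᵥ⇒⊆ᵇ (false ∷ p) (y     ∷ q) p⊆q = ⊆ᵥ⇒⊆ᵇ p q (λ {x} → p⊆q {suc x})

v∉U-ᵥv : ∀ {k} (U : Vec Bool k) v → ¬ v ∈ᵥ U -ᵥ v
v∉U-ᵥv U v v∈ with () ← trans (sym (Vec.lookup∘update v U false)) v∈

∈-ᵥ⁺ : ∀ {k} (U : Vec Bool k) v {x} → x ≢ v → x ∈ᵥ U → x ∈ᵥ U -ᵥ v
∈-ᵥ⁺ U v x≢v x∈U = trans (Vec.lookup∘update′ x≢v U false) x∈U

∈-ᵥ⁻ : ∀ {k} (U : Vec Bool k) v {x} → x ∈ᵥ U -ᵥ v → x ≢ v × x ∈ᵥ U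
∈-ᵥ⁻ U v {x} x∈ with x ≟ v
... | yes refl = ⊥-elim (v∉U-ᵥv U v x∈)
... | no x≢v   = x≢v , trans (sym (Vec.lookup∘update′ x≢v U false)) x∈

¬¬-characteristic : ∀ {k} (P : Fin k → Set) → ¬ ¬ Σ (Vec Bool k) λ χ → ∀ x → x ∈ᵥ χ ⇔ P x
¬¬-characteristic {zero}  P = pure ([] , λ ())
¬¬-characteristic {suc k} P = do
  P0? ← ¬¬-excluded-middle
  (χ , χ⇔P) ← ¬¬-characteristic (P ∘ suc)
  pure (extend P0? χ χ⇔P)
  where
  extend : Dec (P zero) → (χ : Vec Bool k) → (∀ x → x ∈ᵥ χ ⇔ P (suc x)) →
           Σ (Vec Bool (suc k)) λ χ → ∀ x → x ∈ᵥ χ ⇔ P x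
  extend (yes P0) χ χ⇔P = true  ∷ χ , λ { zero → mk⇔ (λ _ → P0) (λ _ → refl) ; (suc x) → χ⇔P x }
  extend (no ¬P0) χ χ⇔P = false ∷ χ , λ { zero → mk⇔ (λ ()) (⊥-elim ∘ ¬P0) ; (suc x) → χ⇔P x }

choose : ℕ → ℕ → ℕ
choose n       zero    = 1
choose zero    (suc k) = 0
choose (suc n) (suc k) = choose n k + choose n (suc k)

choose-1 : ∀ n → choose n 1 ≡ n
choose-1 zero    = refl
choose-1 (suc n) = cong suc (choose-1 n)

module Cliques (G : Graph) where
  open Graph G using (n; adj) renaming (sym to adj-sym; irrefl to adj-irrefl)

  size-ᵥ : ∀ {k} (U : Vec Bool k) v → v ∈ᵥ U → suc (size G (U -ᵥ v)) ≡ size G U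
  size-ᵥ (true  ∷ U) zero    _   = refl
  size-ᵥ (true  ∷ U) (suc v) v∈U = cong suc (size-ᵥ U v v∈U)
  size-ᵥ (false ∷ U) (suc v) v∈U = size-ᵥ U v v∈U

  size-insert : ∀ {k} (U : Vec Bool k) v → lookup U v ≡ false → size G (U [ v ]≔ true) ≡ suc (size G U)
  size-insert (false ∷ U) zero    _   = refl
  size-insert (true  ∷ U) (suc v) v∉U = cong suc (size-insert U v v∉U)
  size-insert (false ∷ U) (suc v) v∉U = size-insert U v v∉U

  size-mono : ∀ {k} (P Q : Vec Bool k) → P ⊆ᵥ Q → size G P ≤ size G Q
  size-mono []          []          _   = z≤n
  size-mono (true  ∷ P) (true  ∷ Q) P⊆Q = s≤s (size-mono P Q (λ {x} → P⊆Q {suc x}))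
  size-mono (true  ∷ P) (false ∷ Q) P⊆Q with () ← P⊆Q {zero} refl
  size-mono (false ∷ P) (true  ∷ Q) P⊆Q = ℕ.m≤n⇒m≤1+n (size-mono P Q (λ {x} → P⊆Q {suc x}))
  size-mono (false ∷ P) (false ∷ Q) P⊆Q = size-mono P Q (λ {x} → P⊆Q {suc x})

  size≤length : ∀ {k} (U : Vec Bool k) → size G U ≤ k
  size≤length []          = z≤n
  size≤length (true  ∷ U) = s≤s (size≤length U)
  size≤length (false ∷ U) = ℕ.m≤n⇒m≤1+n (size≤length U)

  size-replicate : ∀ k → size G (replicate k true) ≡ k
  size-replicate zero    = refl
  size-replicate (suc k) = cong suc (size-replicate k)

  ∈⇒size≥1 : ∀ {k} (U : Vec Bool k) {v} → v ∈ᵥ U → 1 ≤ size G U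
  ∈⇒size≥1 U {v} v∈U = subst (1 ≤_) (size-ᵥ U v v∈U) (s≤s z≤n)

  size≥1⇒∈ : ∀ {k} (U : Vec Bool k) → 1 ≤ size G U → ∃ (_∈ᵥ U)
  size≥1⇒∈ (true  ∷ U) _ = zero , refl
  size≥1⇒∈ (false ∷ U) h with size≥1⇒∈ U h
  ... | x , x∈U = suc x , x∈U

  ⊂⇒size< : ∀ {k} (P U : Vec Bool k) {a} → P ⊆ᵥ U → a ∈ᵥ U → ¬ a ∈ᵥ P → size G P < size G U
  ⊂⇒size< P U {a} P⊆U a∈U a∉P = subst (size G P <_) (size-ᵥ U a a∈U) (s≤s (size-mono P (U -ᵥ a) P⊆U-a))
    where
    P⊆U-a : P ⊆ᵥ U -ᵥ a
    P⊆U-a {x} x∈P = ∈-ᵥ⁺ U a (λ { refl → a∉P x∈P }) (P⊆U x∈P)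

  distinct-members : ∀ {m} k (U : Vec Bool m) → k ≤ size G U →
    Σ (Fin k → Fin m) λ f → Injective _≡_ _≡_ f × (∀ i → f i ∈ᵥ U)
  distinct-members zero    U _  = (λ ()) , (λ { {()} }) , λ ()
  distinct-members (suc k) U k<size with size≥1⇒∈ U (ℕ.≤-trans (s≤s z≤n) k<size)
  ... | x , x∈U with distinct-members k (U -ᵥ x) (ℕ.≤-pred (subst (suc k ≤_) (sym (size-ᵥ U x x∈U)) k<size))
  ...   | g , g-inj , g∈ = f , f-inj , f∈
    where
    f : Fin (suc k) → Fin _
    f zero    = x
    f (suc i) = g i
    f-inj : Injective _≡_ _≡_ f
    f-inj {zero}  {zero}  _  = refl
    f-inj {zero}  {suc j} eq = ⊥-elim (proj₁ (∈-ᵥ⁻ U x (g∈ j)) (sym eq))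
    f-inj {suc i} {zero}  eq = ⊥-elim (proj₁ (∈-ᵥ⁻ U x (g∈ i)) eq)
    f-inj {suc i} {suc j} eq = cong suc (g-inj eq)
    f∈ : ∀ i → f i ∈ᵥ U
    f∈ zero    = x∈U
    f∈ (suc i) = proj₂ (∈-ᵥ⁻ U x (g∈ i))

  count-allSubsets-suc : ∀ k (p : Vec Bool (suc k) → Bool) →
    count p (allSubsets G (suc k))
      ≡ count (λ q → p (true ∷ q)) (allSubsets G k) + count (λ q → p (false ∷ q)) (allSubsets G k)
  count-allSubsets-suc k p = trans (count-++ p (map (true ∷_) subsets) (map (false ∷_) subsets))
    (cong₂ _+_ (count-map p (true ∷_) subsets) (count-map p (false ∷_) subsets))
    where subsets = allSubsets G k

  count-subsets : ∀ k (K : Vec Bool k) j →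
    count (λ p → p ⊆ᵇ K ∧ (size G p ≡ᵇ j)) (allSubsets G k) ≡ choose (size G K) j
  count-subsets zero    []          zero    = refl
  count-subsets zero    []          (suc j) = refl
  count-subsets (suc k) (true ∷ K)  zero    = trans (count-allSubsets-suc k _)
    (cong₂ _+_ (count-none (λ q → ∧-zeroʳ (q ⊆ᵇ K)) (allSubsets G k)) (count-subsets k K zero))
  count-subsets (suc k) (true ∷ K)  (suc j) = trans (count-allSubsets-suc k _)
    (cong₂ _+_ (count-subsets k K j) (count-subsets k K (suc j)))
  count-subsets (suc k) (false ∷ K) j       = trans (count-allSubsets-suc k _)
    (cong₂ _+_ (count-none (λ _ → refl) (allSubsets G k)) (count-subsets k K j))

  infix 4 _~_
  _~_ : Fin n → Fin n → Set
  x ~ y = Adj G x y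

  IsClique : Vec Bool n → Set
  IsClique U = ∀ {x y} → x ∈ᵥ U → y ∈ᵥ U → x ≢ y → x ~ y

  private
    pairᵇ : Vec Bool n → Fin n → Fin n → Bool
    pairᵇ p u v = not (lookup p u ∧ lookup p v) ∨ does (u ≟ v) ∨ adj u v

  isCliqueᵇ-sound : ∀ p → isCliqueᵇ G p ≡ true → IsClique p
  isCliqueᵇ-sound p p-clique {u} {v} u∈p v∈p u≢v =
    entry (All.lookup (all⁺ (pairᵇ p u) (allFin n)
      (All.lookup (all⁺ (λ u → all (pairᵇ p u) (allFin n)) (allFin n) (Equivalence.from T-≡ p-clique)) (∈-allFin u)))
      (∈-allFin v))
    where
    entry : T (pairᵇ p u v) → u ~ v
    entry t rewrite u∈p | v∈p with u ≟ v
    ... | yes u≡v = ⊥-elim (u≢v u≡v)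
    ... | no  _   = Equivalence.to T-≡ t

  isCliqueᵇ-complete : ∀ p → IsClique p → isCliqueᵇ G p ≡ true
  isCliqueᵇ-complete p p-clique =
    Equivalence.to T-≡ (all⁻ (λ u → all (pairᵇ p u) (allFin n))
      (All.tabulate {xs = allFin n} λ {u} _ → all⁻ (pairᵇ p u) (All.tabulate {xs = allFin n} λ {v} _ → entry u v)))
    where
    entry : ∀ u v → T (pairᵇ p u v)
    entry u v with lookup p u in u∈p | lookup p v in v∈p
    ... | false | _     = _
    ... | true  | false = _
    ... | true  | true  with u ≟ v
    ...   | yes _   = _
    ...   | no  u≢v = Equivalence.from T-≡ (p-clique u∈p v∈p u≢v)

  size≤1⇒clique : ∀ p → size G p ≤ 1 → IsClique p
  size≤1⇒clique p size≤1 {u} {v} u∈p v∈p u≢v = ⊥-elim (ℕ.<-irrefl refl (ℕ.≤-trans size≥2 size≤1))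
    where
    size≥2 : 2 ≤ size G p
    size≥2 = subst (2 ≤_) (size-ᵥ p u u∈p)
      (s≤s (∈⇒size≥1 (p -ᵥ u) (∈-ᵥ⁺ p u (λ v≡u → u≢v (sym v≡u)) v∈p)))

  cliqueCountIn : Vec Bool n → ℕ → ℕ
  cliqueCountIn U j = count (λ p → p ⊆ᵇ U ∧ (isCliqueᵇ G p ∧ (size G p ≡ᵇ j))) (allSubsets G n)

  cliqueCount≡cliqueCountIn-⊤ : ∀ j → cliqueCount G j ≡ cliqueCountIn (replicate n true) j
  cliqueCount≡cliqueCountIn-⊤ j = count-cong (λ p →
      cong (_∧ (isCliqueᵇ G p ∧ (size G p ≡ᵇ j))) (sym (⊆ᵥ⇒⊆ᵇ p _ λ {x} _ → Vec.lookup-replicate x true)))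
    (allSubsets G n)

  cliqueCountIn-subsets : ∀ U j → (∀ p → p ⊆ᵥ U → size G p ≡ j → IsClique p) →
                          cliqueCountIn U j ≡ choose (size G U) j
  cliqueCountIn-subsets U j cliques = trans (count-cong same (allSubsets G n)) (count-subsets n U j)
    where
    same : ∀ p → p ⊆ᵇ U ∧ (isCliqueᵇ G p ∧ (size G p ≡ᵇ j)) ≡ p ⊆ᵇ U ∧ (size G p ≡ᵇ j)
    same p with p ⊆ᵇ U in p⊆U | size G p ≡ᵇ j in size≡j
    ... | false | _     = refl
    ... | true  | false = cong (true ∧_) (∧-zeroʳ (isCliqueᵇ G p))
    ... | true  | true  = cong (_∧ true) (isCliqueᵇ-complete p
                            (cliques p (⊆ᵇ⇒⊆ᵥ p U p⊆U) (ℕ.≡ᵇ⇒≡ _ _ (Equivalence.from T-≡ size≡j))))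

  cliqueCountIn-clique : ∀ U j → IsClique U → cliqueCountIn U j ≡ choose (size G U) j
  cliqueCountIn-clique U j U-clique = cliqueCountIn-subsets U j λ p p⊆U _ x∈p y∈p → U-clique (p⊆U x∈p) (p⊆U y∈p)

  cliqueCountIn-≤1 : ∀ U j → j ≤ 1 → cliqueCountIn U j ≡ choose (size G U) j
  cliqueCountIn-≤1 U j j≤1 = cliqueCountIn-subsets U j λ p _ size≡j → size≤1⇒clique p (subst (_≤ 1) (sym size≡j) j≤1)

  cliqueCount-none : ∀ j → (∀ p → IsClique p → size G p ≡ j → ⊥) → cliqueCount G j ≡ 0
  cliqueCount-none j no-clique = count-none none (allSubsets G n)
    where
    none : ∀ p → isCliqueᵇ G p ∧ (size G p ≡ᵇ j) ≡ false
    none p with isCliqueᵇ G p in p-clique | size G p ≡ᵇ j in size≡j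
    ... | false | _     = refl
    ... | true  | false = refl
    ... | true  | true  = ⊥-elim (no-clique p (isCliqueᵇ-sound p p-clique) (ℕ.≡ᵇ⇒≡ _ _ (Equivalence.from T-≡ size≡j)))

  cliqueCount-> : ∀ j → n < j → cliqueCount G j ≡ 0
  cliqueCount-> j n<j = cliqueCount-none j λ p _ size≡j → ℕ.<⇒≱ n<j (subst (_≤ n) size≡j (size≤length p))

  K4Free⇒size≤3 : K4Free G → ∀ W → IsClique W → size G W ≤ 3
  K4Free⇒size≤3 k4free W W-clique with 4 ℕ.≤? size G W
  ... | no  4≰size = ℕ.≤-pred (ℕ.≰⇒> 4≰size)
  ... | yes 4≤size = ⊥-elim (k4free (K4 (distinct-members 4 W 4≤size)))
    where
    K4 : (Σ (Fin 4 → Fin n) λ f → Injective _≡_ _≡_ f × (∀ i → f i ∈ᵥ W)) →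
         Σ (Fin 4 → Fin n) λ f → ∀ i j → i ≢ j → f i ~ f j
    K4 (f , f-inj , f∈W) = f , λ i j i≢j → W-clique (f∈W i) (f∈W j) (λ fi≡fj → i≢j (f-inj fi≡fj))

  cliqueCount-≥4 : K4Free G → ∀ j → 4 ≤ j → cliqueCount G j ≡ 0
  cliqueCount-≥4 k4free j 4≤j = cliqueCount-none j λ p p-clique size≡j →
    ℕ.<⇒≱ 4≤j (subst (_≤ 3) size≡j (K4Free⇒size≤3 k4free p p-clique))

  cliqueCount-0 : cliqueCount G 0 ≡ 1
  cliqueCount-0 = trans (cliqueCount≡cliqueCountIn-⊤ 0) (cliqueCountIn-≤1 (replicate n true) 0 z≤n)

  cliqueCount-1 : cliqueCount G 1 ≡ n
  cliqueCount-1 = trans (cliqueCount≡cliqueCountIn-⊤ 1)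
    (trans (cliqueCountIn-≤1 (replicate n true) 1 ℕ.≤-refl) (trans (choose-1 _) (size-replicate n)))

  ~-sym : ∀ {x y} → x ~ y → y ~ x
  ~-sym {x} {y} x~y = trans (adj-sym y x) x~y

  ~-irrefl : ∀ {x y} → x ~ y → x ≢ y
  ~-irrefl {x} x~x refl with () ← trans (sym (adj-irrefl x)) x~x

  Simplicial : Vec Bool n → Fin n → Set
  Simplicial U v = ∀ {x y} → x ∈ᵥ U → y ∈ᵥ U → v ~ x → v ~ y → x ≢ y → x ~ y

  neighbourhood : Vec Bool n → Fin n → Vec Bool n
  neighbourhood U v = tabulate λ x → lookup U x ∧ adj v x

  ∈-neighbourhood⁻ : ∀ U v {x} → x ∈ᵥ neighbourhood U v → x ∈ᵥ U × v ~ x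
  ∈-neighbourhood⁻ U v {x} x∈N = ∧-conicalˡ _ _ x∈N′ , ∧-conicalʳ _ _ x∈N′
    where x∈N′ = trans (sym (Vec.lookup∘tabulate _ x)) x∈N

  ∈-neighbourhood⁺ : ∀ U v {x} → x ∈ᵥ U → v ~ x → x ∈ᵥ neighbourhood U v
  ∈-neighbourhood⁺ U v {x} x∈U v~x = trans (Vec.lookup∘tabulate _ x) (cong₂ _∧_ x∈U v~x)

  count-split-member : ∀ W v (Z : Vec Bool n → Bool) → v ∈ᵥ W →
    count (λ p → p ⊆ᵇ W ∧ Z p) (allSubsets G n)
      ≡ count (λ p → p ⊆ᵇ W -ᵥ v ∧ Z p) (allSubsets G n)
        + count (λ p → lookup p v ∧ (p ⊆ᵇ W ∧ Z p)) (allSubsets G n)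
  count-split-member W v Z v∈W = count-split split (allSubsets G n)
    where
    split : ∀ p → boolToℕ (p ⊆ᵇ W ∧ Z p)
                    ≡ boolToℕ (p ⊆ᵇ W -ᵥ v ∧ Z p) + boolToℕ (lookup p v ∧ (p ⊆ᵇ W ∧ Z p))
    split p with lookup p v in v∈p
    ... | false = trans (cong (λ b → boolToℕ (b ∧ Z p)) ⊆-same) (sym (ℕ.+-identityʳ _))
      where
      ⊆-same : p ⊆ᵇ W ≡ p ⊆ᵇ W -ᵥ v
      ⊆-same = ⇔→≡ {z = true} (mk⇔
        (λ p⊆W → ⊆ᵥ⇒⊆ᵇ p _ λ x∈p →
          ∈-ᵥ⁺ W v (λ { refl → contradiction (trans (sym v∈p) x∈p) λ () }) (⊆ᵇ⇒⊆ᵥ p W p⊆W x∈p))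
        (λ p⊆W-v → ⊆ᵥ⇒⊆ᵇ p W λ x∈p → proj₂ (∈-ᵥ⁻ W v (⊆ᵇ⇒⊆ᵥ p _ p⊆W-v x∈p))))
    ... | true with p ⊆ᵇ W -ᵥ v in p⊆W-v
    ...   | true  = ⊥-elim (v∉U-ᵥv W v (⊆ᵇ⇒⊆ᵥ p _ p⊆W-v v∈p))
    ...   | false = refl

  -- The cliques of U through a simplicial vertex v are exactly the subsets of its
  -- closed neighbourhood N⁺ that contain v.
  module SimplicialRemoval (U : Vec Bool n) (v : Fin n) (v∈U : v ∈ᵥ U) (simplicial : Simplicial U v) where

    N⁺ : Vec Bool n
    N⁺ = neighbourhood U v [ v ]≔ true

    degree : ℕ
    degree = size G (neighbourhood U v)

    v∉N : lookup (neighbourhood U v) v ≡ false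
    v∉N = trans (Vec.lookup∘tabulate _ v) (trans (cong (lookup U v ∧_) (adj-irrefl v)) (∧-zeroʳ _))

    v∈N⁺ : v ∈ᵥ N⁺
    v∈N⁺ = Vec.lookup∘update v (neighbourhood U v) true

    ∈N⁺⁻ : ∀ {x} → x ∈ᵥ N⁺ → x ≢ v → x ∈ᵥ U × v ~ x
    ∈N⁺⁻ {x} x∈N⁺ x≢v = ∈-neighbourhood⁻ U v (trans (sym (Vec.lookup∘update′ x≢v (neighbourhood U v) true)) x∈N⁺)

    ∈N⁺⁺ : ∀ {x} → x ∈ᵥ U → v ~ x → x ∈ᵥ N⁺
    ∈N⁺⁺ {x} x∈U v~x = trans (Vec.lookup∘update′ (λ { refl → ~-irrefl v~x refl }) (neighbourhood U v) true)
                             (∈-neighbourhood⁺ U v x∈U v~x)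

    N⁺⊆U : N⁺ ⊆ᵥ U
    N⁺⊆U {x} x∈N⁺ with x ≟ v
    ... | yes refl = v∈U
    ... | no  x≢v  = proj₁ (∈N⁺⁻ x∈N⁺ x≢v)

    N⁺-clique : IsClique N⁺
    N⁺-clique {x} {y} x∈N⁺ y∈N⁺ x≢y with x ≟ v | y ≟ v
    ... | yes refl | yes refl = ⊥-elim (x≢y refl)
    ... | yes refl | no  y≢v  = proj₂ (∈N⁺⁻ y∈N⁺ y≢v)
    ... | no  x≢v  | yes refl = ~-sym (proj₂ (∈N⁺⁻ x∈N⁺ x≢v))
    ... | no  x≢v  | no  y≢v  with ∈N⁺⁻ x∈N⁺ x≢v | ∈N⁺⁻ y∈N⁺ y≢v
    ...   | x∈U , v~x | y∈U , v~y = simplicial x∈U y∈U v~x v~y x≢y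

    clique-through-v : ∀ p → v ∈ᵥ p → p ⊆ᵇ U ∧ isCliqueᵇ G p ≡ p ⊆ᵇ N⁺
    clique-through-v p v∈p = ⇔→≡ {z = true} (mk⇔ to from)
      where
      to : p ⊆ᵇ U ∧ isCliqueᵇ G p ≡ true → p ⊆ᵇ N⁺ ≡ true
      to h = ⊆ᵥ⇒⊆ᵇ p N⁺ p⊆N⁺
        where
        p-clique = isCliqueᵇ-sound p (∧-conicalʳ _ _ h)
        p⊆N⁺ : p ⊆ᵥ N⁺
        p⊆N⁺ {x} x∈p with x ≟ v
        ... | yes refl = v∈N⁺
        ... | no  x≢v  = ∈N⁺⁺ (⊆ᵇ⇒⊆ᵥ p U (∧-conicalˡ _ _ h) x∈p)
                              (p-clique v∈p x∈p (λ v≡x → x≢v (sym v≡x)))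
      from : p ⊆ᵇ N⁺ ≡ true → p ⊆ᵇ U ∧ isCliqueᵇ G p ≡ true
      from h = cong₂ _∧_ (⊆ᵥ⇒⊆ᵇ p U (N⁺⊆U ∘′ p⊆N⁺))
                         (isCliqueᵇ-complete p λ x∈p y∈p → N⁺-clique (p⊆N⁺ x∈p) (p⊆N⁺ y∈p))
        where
        p⊆N⁺ : p ⊆ᵥ N⁺
        p⊆N⁺ = ⊆ᵇ⇒⊆ᵥ p N⁺ h

    through-v : ℕ → ℕ
    through-v j = count (λ p → lookup p v ∧ (p ⊆ᵇ N⁺ ∧ (size G p ≡ᵇ j))) (allSubsets G n)

    cliqueCountIn-split : ∀ j → cliqueCountIn U j ≡ cliqueCountIn (U -ᵥ v) j + through-v j
    cliqueCountIn-split j = trans (count-split-member U v (λ p → isCliqueᵇ G p ∧ (size G p ≡ᵇ j)) v∈U)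
                                  (cong (cliqueCountIn (U -ᵥ v) j +_) (count-cong same (allSubsets G n)))
      where
      same : ∀ p → lookup p v ∧ (p ⊆ᵇ U ∧ (isCliqueᵇ G p ∧ (size G p ≡ᵇ j)))
                   ≡ lookup p v ∧ (p ⊆ᵇ N⁺ ∧ (size G p ≡ᵇ j))
      same p with lookup p v in v∈p
      ... | false = refl
      ... | true  = trans (sym (∧-assoc (p ⊆ᵇ U) _ _)) (cong (_∧ (size G p ≡ᵇ j)) (clique-through-v p v∈p))

    size-N⁺ : size G N⁺ ≡ suc degree
    size-N⁺ = size-insert (neighbourhood U v) v v∉N

    choose-split : ∀ j → choose (suc degree) j ≡ choose degree j + through-v j
    choose-split j = begin
      choose (suc degree) j
        ≡⟨ cong (λ s → choose s j) size-N⁺ ⟨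
      choose (size G N⁺) j
        ≡⟨ count-subsets n N⁺ j ⟨
      count (λ p → p ⊆ᵇ N⁺ ∧ (size G p ≡ᵇ j)) (allSubsets G n)
        ≡⟨ count-split-member N⁺ v (λ p → size G p ≡ᵇ j) v∈N⁺ ⟩
      count (λ p → p ⊆ᵇ N⁺ -ᵥ v ∧ (size G p ≡ᵇ j)) (allSubsets G n) + through-v j
        ≡⟨ cong (_+ through-v j) (count-subsets n (N⁺ -ᵥ v) j) ⟩
      choose (size G (N⁺ -ᵥ v)) j + through-v j
        ≡⟨ cong (λ s → choose s j + through-v j) size-N⁺-v ⟩
      choose degree j + through-v j
        ∎
      where
      open ≡-Reasoning
      size-N⁺-v : size G (N⁺ -ᵥ v) ≡ degree
      size-N⁺-v = ℕ.suc-injective (trans (size-ᵥ N⁺ v v∈N⁺) size-N⁺)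

    through-v-suc : ∀ j → through-v (suc j) ≡ choose degree j
    through-v-suc j = ℕ.+-cancelˡ-≡ (choose degree (suc j)) _ _
      (trans (sym (choose-split (suc j))) (ℕ.+-comm (choose degree j) _))

    cliqueCountIn-remove : ∀ j → cliqueCountIn U (suc j) ≡ cliqueCountIn (U -ᵥ v) (suc j) + choose degree j
    cliqueCountIn-remove j = trans (cliqueCountIn-split (suc j)) (cong (cliqueCountIn (U -ᵥ v) (suc j) +_) (through-v-suc j))

    degree≤2 : K4Free G → degree ≤ 2
    degree≤2 k4free = ℕ.≤-pred (subst (_≤ 3) size-N⁺ (K4Free⇒size≤3 k4free N⁺ N⁺-clique))

-- Chordal graphs: detours and simplicial vertices

module Chordality (G : Graph) where
  open Graph G using (n; adj)
  open Cliques G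

  data WalkIn (P : Fin n → Set) : Fin n → Fin n → Set where
    here : ∀ {x} → WalkIn P x x
    step : ∀ {x w y} → P w → x ~ w → WalkIn P w y → WalkIn P x y

  module _ {P : Fin n → Set} where

    walk-snoc : ∀ {x y z} → WalkIn P x y → P z → y ~ z → WalkIn P x z
    walk-snoc here             z∈P y~z = step z∈P y~z here
    walk-snoc (step w∈P x~w ω) z∈P y~z = step w∈P x~w (walk-snoc ω z∈P y~z)

    walk-reverse : ∀ {x y} → P x → WalkIn P x y → WalkIn P y x
    walk-reverse x∈P here             = here
    walk-reverse x∈P (step w∈P x~w ω) = walk-snoc (walk-reverse w∈P ω) x∈P (~-sym x~w)

    walk-++ : ∀ {x y z} → WalkIn P x y → WalkIn P y z → WalkIn P x z
    walk-++ here             ω′ = ω′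
    walk-++ (step w∈P x~w ω) ω′ = step w∈P x~w (walk-++ ω ω′)

    walk-end : ∀ {x y} → P x → WalkIn P x y → P y
    walk-end x∈P here           = x∈P
    walk-end x∈P (step w∈P _ ω) = walk-end w∈P ω

    length : ∀ {x y} → WalkIn P x y → ℕ
    length here         = 0
    length (step _ _ ω) = suc (length ω)

    -- The i-th vertex of a walk, constant after its end.
    vertex : ∀ {x y} → WalkIn P x y → ℕ → Fin n
    vertex {x} here         _       = x
    vertex {x} (step _ _ ω) zero    = x
    vertex     (step _ _ ω) (suc i) = vertex ω i

    vertex-0 : ∀ {x y} (ω : WalkIn P x y) → vertex ω 0 ≡ x
    vertex-0 here         = refl
    vertex-0 (step _ _ ω) = refl

    vertex-length : ∀ {x y} (ω : WalkIn P x y) → vertex ω (length ω) ≡ y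
    vertex-length here         = refl
    vertex-length (step _ _ ω) = vertex-length ω

    vertex-~ : ∀ {x y} (ω : WalkIn P x y) i → i < length ω → vertex ω i ~ vertex ω (suc i)
    vertex-~ (step _ x~w ω) zero    _        = subst (_ ~_) (sym (vertex-0 ω)) x~w
    vertex-~ (step _ _   ω) (suc i) (s≤s i<) = vertex-~ ω i i<

    vertex-∈ : ∀ {x y} → P x → (ω : WalkIn P x y) → ∀ i → P (vertex ω i)
    vertex-∈ x∈P here           _       = x∈P
    vertex-∈ x∈P (step _ _ ω)   zero    = x∈P
    vertex-∈ x∈P (step w∈P _ ω) (suc i) = vertex-∈ w∈P ω i

  Outside : Fin n → Fin n → Set
  Outside a z = z ≢ a × ¬ a ~ z

  -- Together with a, the path h 0 , … , h k closes a cycle through a.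
  record Detour (a : Fin n) (k : ℕ) (h : ℕ → Fin n) : Set where
    field
      start            : a ~ h 0
      end              : a ~ h k
      ends-nonadjacent : ¬ h 0 ~ h k
      ends-distinct    : h 0 ≢ h k
      steps            : ∀ i → i < k → h i ~ h (suc i)
      interior         : ∀ i → 1 ≤ i → i < k → Outside a (h i)

  -- h with the positions p + 1 , … , p + δ cut out
  skip : ℕ → ℕ → (ℕ → Fin n) → ℕ → Fin n
  skip p δ h i with i ≤? p
  ... | yes _ = h i
  ... | no  _ = h (i + δ)

  skip-≤ : ∀ {p δ} h {i} → i ≤ p → skip p δ h i ≡ h i
  skip-≤ {p} h {i} i≤p with i ≤? p
  ... | yes _   = refl
  ... | no  i≰p = ⊥-elim (i≰p i≤p)

  skip-> : ∀ {p δ} h {i} → ¬ i ≤ p → skip p δ h i ≡ h (i + δ)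
  skip-> {p} h {i} i≰p with i ≤? p
  ... | yes i≤p = ⊥-elim (i≰p i≤p)
  ... | no  _   = refl

  splice : ∀ {a k h} → Detour a k h → ∀ p δ → 1 ≤ δ → p + δ ≤ k →
           (p + δ < k → h p ~ h (suc (p + δ))) → (p + δ ≡ k → h p ≡ h k) →
           Detour a (k ∸ δ) (skip p δ h)
  splice {a} {k} {h} D p δ 1≤δ p+δ≤k join close = record
    { start            = subst (a ~_) (sym h′0) start
    ; end              = subst (a ~_) (sym h′k′) end
    ; ends-nonadjacent = λ h′0~h′k′ → ends-nonadjacent (subst₂ _~_ h′0 h′k′ h′0~h′k′)
    ; ends-distinct    = λ h′0≡h′k′ → ends-distinct (trans (sym h′0) (trans h′0≡h′k′ h′k′))
    ; steps            = steps′
    ; interior         = interior′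
    }
    where
    open Detour D
    k′ = k ∸ δ
    h′ = skip p δ h
    k′+δ≡k : k′ + δ ≡ k
    k′+δ≡k = ℕ.m∸n+n≡m (ℕ.≤-trans (ℕ.m≤n+m δ p) p+δ≤k)
    p<k : p < k
    p<k = ℕ.<-≤-trans (ℕ.m<m+n p 1≤δ) p+δ≤k
    shift : ∀ {i} → i < k′ → i + δ < k
    shift i<k′ = subst (_ <_) k′+δ≡k (ℕ.+-monoˡ-< δ i<k′)
    h′0 : h′ 0 ≡ h 0
    h′0 = skip-≤ {p} {δ} h z≤n
    h′k′ : h′ k′ ≡ h k
    h′k′ = by-cases (k′ ≤? p)
      where
      by-cases : Dec (k′ ≤ p) → h′ k′ ≡ h k
      by-cases (no  k′≰p) = trans (skip-> h k′≰p) (cong h k′+δ≡k)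
      by-cases (yes k′≤p) = trans (skip-≤ h k′≤p) (trans (cong h k′≡p) (close p+δ≡k))
        where
        p+δ≡k : p + δ ≡ k
        p+δ≡k = ℕ.≤-antisym p+δ≤k (subst (_≤ p + δ) k′+δ≡k (ℕ.+-monoˡ-≤ δ k′≤p))
        k′≡p : k′ ≡ p
        k′≡p = ℕ.+-cancelʳ-≡ δ k′ p (trans k′+δ≡k (sym p+δ≡k))
    steps′ : ∀ i → i < k′ → h′ i ~ h′ (suc i)
    steps′ i i<k′ = by-cases (suc i ≤? p) (i ≤? p)
      where
      by-cases : Dec (suc i ≤ p) → Dec (i ≤ p) → h′ i ~ h′ (suc i)
      by-cases (yes i<p) _ = subst₂ _~_ (sym (skip-≤ h (ℕ.<⇒≤ i<p))) (sym (skip-≤ h i<p))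
                                (steps i (ℕ.<-trans i<p p<k))
      by-cases (no  i≮p) (yes i≤p) = subst₂ _~_ (sym (trans (skip-≤ h i≤p) (cong h i≡p)))
                                (sym (trans (skip-> h i≮p) (cong (λ j → h (suc j + δ)) i≡p)))
                                (join (subst (λ j → j + δ < k) i≡p (shift i<k′)))
        where
        i≡p : i ≡ p
        i≡p = ℕ.≤-antisym i≤p (ℕ.≤-pred (ℕ.≰⇒> i≮p))
      by-cases (no  i≮p) (no  i≰p) = subst₂ _~_ (sym (skip-> h i≰p)) (sym (skip-> h i≮p)) (steps (i + δ) (shift i<k′))
    interior′ : ∀ i → 1 ≤ i → i < k′ → Outside a (h′ i)
    interior′ i 1≤i i<k′ = by-cases (i ≤? p)
      where
      by-cases : Dec (i ≤ p) → Outside a (h′ i)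
      by-cases (yes i≤p) = subst (Outside a) (sym (skip-≤ h i≤p)) (interior i 1≤i (ℕ.≤-<-trans i≤p p<k))
      by-cases (no  i≰p) = subst (Outside a) (sym (skip-> h i≰p))
                      (interior (i + δ) (ℕ.≤-trans 1≤i (ℕ.m≤m+n i δ)) (shift i<k′))

  Shortcut : ℕ → (ℕ → Fin n) → Set
  Shortcut k h = Σ ℕ λ p → Σ ℕ λ q → p < q × q ≤ k × (h p ≡ h q ⊎ (suc p < q × h p ~ h q))

  shorten : ∀ {a k h} → Detour a k h → Shortcut k h →
            Σ ℕ λ k′ → Σ (ℕ → Fin n) λ h′ → k′ < k × Detour a k′ h′
  shorten {k = k} {h} D (p , q , p<q , q≤k , inj₁ hp≡hq) =
    k ∸ δ , skip p δ h , ℕ.∸-monoʳ-< 1≤δ δ≤k , splice D p δ 1≤δ (subst (_≤ k) (sym p+δ≡q) q≤k) join close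
    where
    δ = q ∸ p
    1≤δ = ℕ.m<n⇒0<n∸m p<q
    p+δ≡q : p + δ ≡ q
    p+δ≡q = ℕ.m+[n∸m]≡n (ℕ.<⇒≤ p<q)
    δ≤k = ℕ.≤-trans (ℕ.m≤n+m δ p) (subst (_≤ k) (sym p+δ≡q) q≤k)
    join : p + δ < k → h p ~ h (suc (p + δ))
    join p+δ<k rewrite p+δ≡q = subst (_~ h (suc q)) (sym hp≡hq) (Detour.steps D q p+δ<k)
    close : p + δ ≡ k → h p ≡ h k
    close p+δ≡k = trans hp≡hq (cong h (trans (sym p+δ≡q) p+δ≡k))
  shorten {k = k} {h} D (p , q , p<q , q≤k , inj₂ (p+1<q , hp~hq)) =
    k ∸ δ , skip p δ h , ℕ.∸-monoʳ-< 1≤δ δ≤k , splice D p δ 1≤δ p+δ≤k join close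
    where
    δ = q ∸ suc p
    1≤δ = ℕ.m<n⇒0<n∸m p+1<q
    p+1+δ≡q : suc p + δ ≡ q
    p+1+δ≡q = ℕ.m+[n∸m]≡n (ℕ.<⇒≤ p+1<q)
    p+δ<k : p + δ < k
    p+δ<k = subst (_≤ k) (sym p+1+δ≡q) q≤k
    p+δ≤k = ℕ.<⇒≤ p+δ<k
    δ≤k = ℕ.≤-trans (ℕ.m≤n+m δ p) p+δ≤k
    join : p + δ < k → h p ~ h (suc (p + δ))
    join _ = subst (λ j → h p ~ h j) (sym p+1+δ≡q) hp~hq
    close : p + δ ≡ k → h p ≡ h k
    close p+δ≡k = ⊥-elim (ℕ.<-irrefl p+δ≡k p+δ<k)

  -- Without a shortcut, a , h 0 , … , h k is a chordless cycle of length k + 2.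
  detour-has-shortcut : Chordal G → ∀ {a k h} → Detour a k h → ¬ ¬ Shortcut k h
  detour-has-shortcut chordal {k = zero}  D _ = Detour.ends-distinct D refl
  detour-has-shortcut chordal {k = suc zero} D _ = Detour.ends-nonadjacent D (Detour.steps D 0 (s≤s z≤n))
  detour-has-shortcut chordal {a} {suc (suc m)} {h} D no-shortcut = chord-absent (chordal cycle)
    where
    open Detour D
    k = suc (suc m)

    c : ℕ → Fin n
    c zero    = a
    c (suc j) = h j

    bound : ∀ (i : Fin (m + 4)) → toℕ i ≤ suc k
    bound i = ℕ.≤-pred (subst (toℕ i <_) (ℕ.+-comm m 4) (Fin.toℕ<n i))

    a∉h : ∀ q → q ≤ k → a ≢ h q
    a∉h zero      _   a≡h0 = ~-irrefl start a≡h0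
    a∉h q@(suc _) q≤k a≡hq with q ℕ.≟ k
    ... | yes refl = ~-irrefl end a≡hq
    ... | no  q≢k  = proj₁ (interior q (s≤s z≤n) (ℕ.≤∧≢⇒< q≤k q≢k)) (sym a≡hq)

    h-injective : ∀ p q → p ≤ k → q ≤ k → h p ≡ h q → p ≡ q
    h-injective p q p≤k q≤k hp≡hq with ℕ.<-cmp p q
    ... | tri< p<q _ _ = ⊥-elim (no-shortcut (p , q , p<q , q≤k , inj₁ hp≡hq))
    ... | tri≈ _ p≡q _ = p≡q
    ... | tri> _ _ q<p = ⊥-elim (no-shortcut (q , p , q<p , p≤k , inj₁ (sym hp≡hq)))

    c-injective : ∀ p q → p ≤ suc k → q ≤ suc k → c p ≡ c q → p ≡ q
    c-injective zero    zero    _   _   _  = refl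
    c-injective zero    (suc q) _   q≤  eq = ⊥-elim (a∉h q (ℕ.≤-pred q≤) eq)
    c-injective (suc p) zero    p≤  _   eq = ⊥-elim (a∉h p (ℕ.≤-pred p≤) (sym eq))
    c-injective (suc p) (suc q) p≤  q≤  eq = cong suc (h-injective p q (ℕ.≤-pred p≤) (ℕ.≤-pred q≤) eq)

    c-steps : ∀ p → p ≤ k → c p ~ c (suc p)
    c-steps zero    _   = start
    c-steps (suc p) p<k = steps p p<k

    cycle : LongCycle G
    cycle = record
      { m     = m
      ; f     = c ∘ toℕ
      ; f-inj = λ {i} {j} eq → Fin.toℕ-injective (c-injective (toℕ i) (toℕ j) (bound i) (bound j) eq)
      ; edges = edges
      }
      where
      edges : ∀ i j → CycNext G i j → c (toℕ i) ~ c (toℕ j)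
      edges i j (inj₁ i+1≡j) = subst (λ t → c (toℕ i) ~ c t) i+1≡j
                                 (c-steps (toℕ i) (ℕ.≤-pred (subst (_≤ suc k) (sym i+1≡j) (bound j))))
      edges i j (inj₂ (i+1≡m+4 , j≡0)) rewrite j≡0 | ℕ.suc-injective (trans i+1≡m+4 (ℕ.+-comm m 4)) = ~-sym end

    non-edge : ∀ p q → p < q → q ≤ suc k → suc p ≢ q → ¬ (p ≡ 0 × q ≡ suc k) → ¬ c p ~ c q
    non-edge zero (suc q) _ q≤ p+1≢q not-closing a~hq with q ℕ.≟ 0 | q ℕ.≟ k
    ... | yes refl | _        = p+1≢q refl
    ... | no  _    | yes refl = not-closing (refl , refl)
    ... | no  q≢0  | no  q≢k  = proj₂ (interior q (ℕ.n≢0⇒n>0 q≢0) (ℕ.≤∧≢⇒< (ℕ.≤-pred q≤) q≢k)) a~hq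
    non-edge (suc p) (suc q) p<q q≤ p+1≢q _ hp~hq =
      no-shortcut (p , q , ℕ.≤-pred p<q , ℕ.≤-pred q≤ , inj₂ (ℕ.≤-pred (ℕ.≤∧≢⇒< p<q p+1≢q) , hp~hq))

    chord-absent : ¬ HasChord G cycle
    chord-absent (i , j , i≢j , ¬i→j , ¬j→i , ci~cj) with ℕ.<-cmp (toℕ i) (toℕ j)
    ... | tri< i<j _ _ = non-edge (toℕ i) (toℕ j) i<j (bound j) (¬i→j ∘ inj₁)
                           (λ (i≡0 , j≡k+1) → ¬j→i (inj₂ (trans (cong suc j≡k+1) (ℕ.+-comm 4 m) , i≡0))) ci~cj
    ... | tri≈ _ i≡j _ = i≢j (Fin.toℕ-injective i≡j)
    ... | tri> _ _ j<i = non-edge (toℕ j) (toℕ i) j<i (bound i) (¬j→i ∘ inj₁)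
                           (λ (j≡0 , i≡k+1) → ¬i→j (inj₂ (trans (cong suc i≡k+1) (ℕ.+-comm 4 m) , j≡0))) (~-sym ci~cj)

  no-detour : Chordal G → ∀ {a} k h → ¬ Detour a k h
  no-detour chordal {a} = <-rec (λ k → ∀ h → ¬ Detour a k h) λ k shorter h D →
    detour-has-shortcut chordal D λ shortcut →
      let k′ , h′ , k′<k , D′ = shorten D shortcut in shorter k′<k h′ D′

  _~?_ : ∀ x y → Dec (x ~ y)
  x ~? y = adj x y Bool.≟ true

  ¬clique⇒nonadjacent-pair : ∀ W → ¬ IsClique W →
    ¬ ¬ Σ (Fin n) λ x → Σ (Fin n) λ y → x ∈ᵥ W × y ∈ᵥ W × x ≢ y × ¬ x ~ y
  ¬clique⇒nonadjacent-pair W ¬clique no-pair = ¬clique clique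
    where
    clique : IsClique W
    clique {x} {y} x∈W y∈W x≢y with x ~? y
    ... | yes x~y = x~y
    ... | no ¬x~y = ⊥-elim (no-pair (x , y , x∈W , y∈W , x≢y , ¬x~y))

  -- The component of u in U minus the closed neighbourhood of a, and its boundary.
  module Separation (chordal : Chordal G) (U : Vec Bool n) {a u : Fin n} (u∈U : u ∈ᵥ U) (u-out : Outside a u) where

    Inside : Fin n → Set
    Inside z = z ∈ᵥ U × Outside a z

    Component : Fin n → Set
    Component = WalkIn Inside u

    Boundary : Fin n → Set
    Boundary z = z ∈ᵥ U × ¬ Component z × Σ (Fin n) λ c → Component c × z ~ c

    component⇒inside : ∀ {z} → Component z → Inside z
    component⇒inside = walk-end (u∈U , u-out)

    boundary⇒~a : ∀ {z} → Boundary z → a ~ z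
    boundary⇒~a {z} (z∈U , z∉C , c , c∈C , z~c) with a ~? z
    ... | yes a~z = a~z
    ... | no ¬a~z = ⊥-elim (z∉C (walk-snoc c∈C (z∈U , z≢a , ¬a~z) (~-sym z~c)))
      where
      z≢a : z ≢ a
      z≢a refl = proj₂ (proj₂ (component⇒inside c∈C)) z~c

    -- Two boundary vertices and a path between them through the component form a
    -- detour, so by chordality they are adjacent.
    boundary-clique : ∀ {x y} → Boundary x → Boundary y → x ≢ y → x ~ y
    boundary-clique {x} {y} x∈B@(_ , _ , c , c∈C , x~c) y∈B@(_ , _ , c′ , c′∈C , y~c′) x≢y with x ~? y
    ... | yes x~y = x~y
    ... | no ¬x~y = ⊥-elim (no-detour chordal (suc (suc (length ω))) h detour)
      where
      ω : WalkIn Inside c c′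
      ω = walk-++ (walk-reverse (u∈U , u-out) c∈C) c′∈C
      h : ℕ → Fin n
      h zero    = x
      h (suc i) with i ≤? length ω
      ... | yes _ = vertex ω i
      ... | no  _ = y
      h-inner : ∀ {i} → i ≤ length ω → h (suc i) ≡ vertex ω i
      h-inner {i} i≤ with i ≤? length ω
      ... | yes _  = refl
      ... | no  i≰ = ⊥-elim (i≰ i≤)
      h-after : ∀ {i} → ¬ i ≤ length ω → h (suc i) ≡ y
      h-after {i} i≰ with i ≤? length ω
      ... | yes i≤ = ⊥-elim (i≰ i≤)
      ... | no  _  = refl
      h-last : h (suc (suc (length ω))) ≡ y
      h-last = h-after ℕ.1+n≰n
      detour : Detour a (suc (suc (length ω))) h
      detour = record
        { start            = boundary⇒~a x∈B
        ; end              = subst (a ~_) (sym h-last) (boundary⇒~a y∈B)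
        ; ends-nonadjacent = λ x~h → ¬x~y (subst (x ~_) h-last x~h)
        ; ends-distinct    = λ x≡h → x≢y (trans x≡h h-last)
        ; steps            = steps
        ; interior         = interior
        }
        where
        steps : ∀ i → i < suc (suc (length ω)) → h i ~ h (suc i)
        steps zero _ = subst (x ~_) (sym (trans (h-inner z≤n) (vertex-0 ω))) x~c
        steps (suc i) (s≤s i≤) = by-cases (suc i ≤? length ω)
          where
          by-cases : Dec (suc i ≤ length ω) → h (suc i) ~ h (suc (suc i))
          by-cases (yes i<) = subst₂ _~_ (sym (h-inner (ℕ.<⇒≤ i<))) (sym (h-inner i<)) (vertex-~ ω i i<)
          by-cases (no  i≮) = subst₂ _~_ (sym (trans (h-inner (ℕ.≤-pred i≤)) (trans (cong (vertex ω) i≡) (vertex-length ω))))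
                                (sym (h-after i≮)) (~-sym y~c′)
            where
            i≡ : i ≡ length ω
            i≡ = ℕ.≤-antisym (ℕ.≤-pred i≤) (ℕ.≤-pred (ℕ.≰⇒> i≮))
        interior : ∀ i → 1 ≤ i → i < suc (suc (length ω)) → Outside a (h i)
        interior (suc i) _ (s≤s i≤) =
          subst (Outside a) (sym (h-inner (ℕ.≤-pred i≤))) (proj₂ (vertex-∈ (component⇒inside c∈C) ω i))

    module _ (W : Vec Bool n) (∈W : ∀ z → z ∈ᵥ W ⇔ (Component z ⊎ Boundary z)) where

      W⊆U : W ⊆ᵥ U
      W⊆U {z} z∈W with Equivalence.to (∈W z) z∈W
      ... | inj₁ z∈C = proj₁ (component⇒inside z∈C)
      ... | inj₂ z∈B = proj₁ z∈B

      a∉W : ¬ a ∈ᵥ W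
      a∉W a∈W with Equivalence.to (∈W a) a∈W
      ... | inj₁ a∈C = proj₁ (proj₂ (component⇒inside a∈C)) refl
      ... | inj₂ a∈B = ~-irrefl (boundary⇒~a a∈B) refl

      neighbours⊆W : ∀ {v y} → Component v → y ∈ᵥ U → v ~ y → y ∈ᵥ W
      neighbours⊆W {v} {y} v∈C y∈U v~y with a ~? y
      ... | yes a~y = Equivalence.from (∈W y)
                        (inj₂ (y∈U , (λ y∈C → proj₂ (proj₂ (component⇒inside y∈C)) a~y) , v , v∈C , ~-sym v~y))
      ... | no ¬a~y = Equivalence.from (∈W y) (inj₁ (walk-snoc v∈C (y∈U , y≢a , ¬a~y) v~y))
        where
        y≢a : y ≢ a
        y≢a refl = proj₂ (proj₂ (component⇒inside v∈C)) (~-sym v~y)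

      simplicial-in-U : ∀ {v} → Component v → Simplicial W v → Simplicial U v
      simplicial-in-U v∈C v-simplicial {x} {y} x∈U y∈U v~x v~y =
        v-simplicial (neighbours⊆W v∈C x∈U v~x) (neighbours⊆W v∈C y∈U v~y) v~x v~y

      -- Recursing on such a pair yields a vertex outside the boundary.
      SeparatingPair : Set
      SeparatingPair = Σ (Fin n) λ x → Σ (Fin n) λ y →
        x ∈ᵥ W × y ∈ᵥ W × x ≢ y × ¬ x ~ y × (∀ {v} → v ≢ x → ¬ x ~ v → ¬ Boundary v)

      separating-pair : ¬ IsClique W → ¬ ¬ SeparatingPair
      separating-pair ¬clique = ¬¬-excluded-middle >>= by-cases
        where
        Deficient : Set
        Deficient = Σ (Fin n) λ s → Σ (Fin n) λ w → Boundary s × w ∈ᵥ W × w ≢ s × ¬ s ~ w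
        by-cases : Dec Deficient → ¬ ¬ SeparatingPair
        by-cases (yes (s , w , s∈B , w∈W , w≢s , ¬s~w)) =
          pure (s , w , Equivalence.from (∈W s) (inj₂ s∈B) , w∈W , w≢s ∘ sym , ¬s~w ,
                λ {v} v≢s ¬s~v v∈B → ¬s~v (boundary-clique s∈B v∈B (v≢s ∘ sym)))
        by-cases (no ¬deficient) = do
          (x , y , x∈W , y∈W , x≢y , ¬x~y) ← ¬clique⇒nonadjacent-pair W ¬clique
          pure (x , y , x∈W , y∈W , x≢y , ¬x~y ,
                λ {v} v≢x ¬x~v v∈B → ¬deficient (v , x , v∈B , x∈W , v≢x ∘ sym , ¬x~v ∘ ~-sym))

  -- Dirac's lemma: a vertex u outside the closed neighbourhood of a leads to a
  -- simplicial vertex outside it, found recursively inside the component of u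
  -- together with its boundary, which is a clique.
  simplicial-outside : Chordal G → ∀ s (U : Vec Bool n) → size G U ≤ s → ∀ {a u} → a ∈ᵥ U → u ∈ᵥ U → Outside a u →
    ¬ ¬ Σ (Fin n) λ v → v ∈ᵥ U × Outside a v × Simplicial U v
  simplicial-outside chordal zero    U size≤0 a∈U _ _ _ = ℕ.1+n≰n (ℕ.≤-trans (∈⇒size≥1 U a∈U) size≤0)
  simplicial-outside chordal (suc s) U size≤ {a} {u} a∈U u∈U u-out =
    ¬¬-characteristic (λ z → Component z ⊎ Boundary z) >>= λ (W , ∈W) → ¬¬-excluded-middle >>= conclude W ∈W
    where
    open Separation chordal U u∈U u-out
    conclude : ∀ W ∈W → Dec (IsClique W) → ¬ ¬ Σ (Fin n) λ v → v ∈ᵥ U × Outside a v × Simplicial U v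
    conclude W ∈W (yes W-clique) = pure (u , u∈U , u-out , λ {x} {y} x∈U y∈U u~x u~y →
      W-clique (neighbours⊆W W ∈W here x∈U u~x) (neighbours⊆W W ∈W here y∈U u~y))
    conclude W ∈W (no ¬clique) = do
      (x , y , x∈W , y∈W , x≢y , ¬x~y , avoids-boundary) ← separating-pair W ∈W ¬clique
      (v , v∈W , (v≢x , ¬x~v) , v-simplicial) ← simplicial-outside chordal s W size-W x∈W y∈W (x≢y ∘ sym , ¬x~y)
      let v∈C = in-component (Equivalence.to (∈W v) v∈W) (avoids-boundary v≢x ¬x~v)
      pure ( v , proj₁ (component⇒inside v∈C) , proj₂ (component⇒inside v∈C)
           , λ {x} {y} → simplicial-in-U W ∈W v∈C v-simplicial {x} {y})
      where
      size-W : size G W ≤ s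
      size-W = ℕ.≤-pred (ℕ.≤-trans (⊂⇒size< W U (W⊆U W ∈W) a∈U (a∉W W ∈W)) size≤)
      in-component : ∀ {v} → Component v ⊎ Boundary v → ¬ Boundary v → Component v
      in-component (inj₁ v∈C) _   = v∈C
      in-component (inj₂ v∈B) v∉B = ⊥-elim (v∉B v∈B)

  simplicial-exists : Chordal G → ∀ U → 1 ≤ size G U → ¬ ¬ Σ (Fin n) λ v → v ∈ᵥ U × Simplicial U v
  simplicial-exists chordal U size≥1 = ¬¬-excluded-middle >>= by-cases
    where
    by-cases : Dec (IsClique U) → ¬ ¬ Σ (Fin n) λ v → v ∈ᵥ U × Simplicial U v
    by-cases (yes U-clique) = let a , a∈U = size≥1⇒∈ U size≥1 in
      pure (a , a∈U , λ {x} {y} x∈U y∈U _ _ → U-clique x∈U y∈U)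
    by-cases (no ¬clique) = do
      (x , y , x∈U , y∈U , x≢y , ¬x~y) ← ¬clique⇒nonadjacent-pair U ¬clique
      (v , v∈U , _ , v-simplicial) ← simplicial-outside chordal (size G U) U ℕ.≤-refl x∈U y∈U (x≢y ∘ sym , ¬x~y)
      pure (v , v∈U , λ {x} {y} → v-simplicial {x} {y})

-- Clique counts of connected chordal K₄-free graphs

4t≤[1+t]² : ∀ t → 4 * t ≤ suc t * suc t
4t≤[1+t]² zero    = z≤n
4t≤[1+t]² (suc t) = subst₂ _≤_ (sym (lhs t)) (sym (rhs t)) (ℕ.m≤n+m (4 * t + 4) (t * t))
  where
  lhs : ∀ t → 4 * suc t ≡ 4 * t + 4
  lhs = solve-∀
  rhs : ∀ t → suc (suc t) * suc (suc t) ≡ t * t + (4 * t + 4)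
  rhs = solve-∀

discriminant-nonneg : ∀ t m → t + 2 ≤ suc m → 4 * t ≤ m * m
discriminant-nonneg t m t+2≤1+m = ℕ.≤-trans (4t≤[1+t]² t) (ℕ.*-mono-≤ 1+t≤m 1+t≤m)
  where
  1+t≤m : suc t ≤ m
  1+t≤m = ℕ.≤-pred (subst (_≤ suc m) (ℕ.+-comm t 2) t+2≤1+m)

module Counting (G : Graph) where
  open Graph G using (n; adj)
  open Cliques G
  open Chordality G
  ConnectedIn : Vec Bool n → Set
  ConnectedIn U = ∀ {x y} → x ∈ᵥ U → y ∈ᵥ U → WalkIn (_∈ᵥ U) x y

  module _ (U : Vec Bool n) (v : Fin n) (simplicial : Simplicial U v) where

    -- A walk entering v can jump from the vertex before v to the vertex after it.
    bypass : ∀ {x y} → x ≢ v → y ≢ v → x ∈ᵥ U → WalkIn (_∈ᵥ U) x y → WalkIn (_∈ᵥ U -ᵥ v) x y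
    bypass-v : ∀ {x y} → x ≢ v → y ≢ v → x ∈ᵥ U → x ~ v → WalkIn (_∈ᵥ U) v y → WalkIn (_∈ᵥ U -ᵥ v) x y
    bypass x≢v y≢v x∈U here = here
    bypass x≢v y≢v x∈U (step {w = w} w∈U x~w ω) with w ≟ v
    ... | no  w≢v  = step (∈-ᵥ⁺ U v w≢v w∈U) x~w (bypass w≢v y≢v w∈U ω)
    ... | yes refl = bypass-v x≢v y≢v x∈U x~w ω
    bypass-v x≢v y≢v x∈U x~v here = ⊥-elim (y≢v refl)
    bypass-v {x} x≢v y≢v x∈U x~v (step {w = w} w∈U v~w ω) with x ≟ w
    ... | yes refl = bypass x≢v y≢v x∈U ω
    ... | no  x≢w  = step (∈-ᵥ⁺ U v w≢v w∈U) (simplicial x∈U w∈U (~-sym x~v) v~w x≢w) (bypass w≢v y≢v w∈U ω)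
      where
      w≢v : w ≢ v
      w≢v w≡v = ~-irrefl v~w (sym w≡v)

    remove-simplicial-connected : ConnectedIn U → ConnectedIn (U -ᵥ v)
    remove-simplicial-connected U-connected x∈ y∈ with ∈-ᵥ⁻ U v x∈ | ∈-ᵥ⁻ U v y∈
    ... | x≢v , x∈U | y≢v , y∈U = bypass x≢v y≢v x∈U (U-connected x∈U y∈U)

  -- euler is c₁ − c₂ + c₃ = 1; triangles keeps the final discriminant nonnegative.
  record CliqueCounts (U : Vec Bool n) : Set where
    field
      euler     : cliqueCountIn U 2 + 1 ≡ size G U + cliqueCountIn U 3
      triangles : cliqueCountIn U 3 ≡ 0 ⊎ cliqueCountIn U 3 + 2 ≤ size G U

  CliqueCounts-stable : ∀ U → ¬ ¬ CliqueCounts U → CliqueCounts U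
  CliqueCounts-stable U ¬¬counts = record
    { euler     = decidable-stable (_ ℕ.≟ _) (¬¬-map CliqueCounts.euler ¬¬counts)
    ; triangles = decidable-stable ((_ ℕ.≟ 0) ⊎-dec (_ ≤? _)) (¬¬-map CliqueCounts.triangles ¬¬counts)
    }

  counts-step : ∀ d {c₂ c₃ c₂′ c₃′ s′} → 1 ≤ d → d ≤ 2 → (d ≡ 2 → 2 ≤ s′) →
    c₂ ≡ c₂′ + d → c₃ ≡ c₃′ + choose d 2 →
    c₂′ + 1 ≡ s′ + c₃′ → c₃′ ≡ 0 ⊎ c₃′ + 2 ≤ s′ →
    (c₂ + 1 ≡ suc s′ + c₃) × (c₃ ≡ 0 ⊎ c₃ + 2 ≤ suc s′)
  counts-step 1 {c₂′ = c₂′} {c₃′} {s′} _ _ _ refl refl euler′ triangles′ =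
    trans (cong (_+ 1) euler′) (+-lemma s′ c₃′) , triangles triangles′
    where
    +-lemma : ∀ a b → a + b + 1 ≡ suc a + (b + 0)
    +-lemma = solve-∀
    triangles : c₃′ ≡ 0 ⊎ c₃′ + 2 ≤ s′ → c₃′ + 0 ≡ 0 ⊎ c₃′ + 0 + 2 ≤ suc s′
    triangles (inj₁ c₃′≡0) = inj₁ (trans (ℕ.+-identityʳ c₃′) c₃′≡0)
    triangles (inj₂ bound) = inj₂ (ℕ.m≤n⇒m≤1+n (subst (λ c → c + 2 ≤ s′) (sym (ℕ.+-identityʳ c₃′)) bound))
  counts-step 2 {c₂′ = c₂′} {c₃′} {s′} _ _ s′≥2 refl refl euler′ triangles′ =
    trans (+-lemma₁ c₂′) (trans (cong (_+ 2) euler′) (+-lemma₂ s′ c₃′)) , inj₂ (triangles triangles′)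
    where
    +-lemma₁ : ∀ c → c + 2 + 1 ≡ c + 1 + 2
    +-lemma₁ = solve-∀
    +-lemma₂ : ∀ a b → a + b + 2 ≡ suc a + (b + 1)
    +-lemma₂ = solve-∀
    +-lemma₃ : ∀ c → c + 1 + 2 ≡ suc (c + 2)
    +-lemma₃ = solve-∀
    triangles : c₃′ ≡ 0 ⊎ c₃′ + 2 ≤ s′ → c₃′ + 1 + 2 ≤ suc s′
    triangles (inj₁ refl) = s≤s (s′≥2 refl)
    triangles (inj₂ bound) = subst (_≤ suc s′) (sym (+-lemma₃ c₃′)) (s≤s bound)
  counts-step (suc (suc (suc _))) _ (s≤s (s≤s ())) _ _ _ _ _

  clique-counts : Chordal G → K4Free G → ∀ s U → size G U ≡ suc s → ConnectedIn U → CliqueCounts U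
  clique-counts _ _ zero U size≡1 _ = record
    { euler     = trans (cong (_+ 1) (no-edges 0)) (sym (cong₂ _+_ size≡1 (no-edges 1)))
    ; triangles = inj₁ (no-edges 1)
    }
    where
    no-edges : ∀ j → cliqueCountIn U (2 + j) ≡ 0
    no-edges j = trans (cliqueCountIn-clique U (2 + j) (size≤1⇒clique U (ℕ.≤-reflexive size≡1)))
                       (cong (λ s → choose s (2 + j)) size≡1)
  clique-counts chordal k4free (suc s) U size≡ U-connected = CliqueCounts-stable U do
    (v , v∈U , simplicial) ← simplicial-exists chordal U (subst (1 ≤_) (sym size≡) (s≤s z≤n))
    pure (remove v v∈U simplicial)
    where
    remove : ∀ v → v ∈ᵥ U → Simplicial U v → CliqueCounts U
    remove v v∈U simplicial = record
      { euler     = subst (λ t → cliqueCountIn U 2 + 1 ≡ t + cliqueCountIn U 3) size-U (proj₁ after-removal)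
      ; triangles = subst (λ t → cliqueCountIn U 3 ≡ 0 ⊎ cliqueCountIn U 3 + 2 ≤ t) size-U (proj₂ after-removal)
      }
      where
      open SimplicialRemoval U v v∈U simplicial
      U′ = U -ᵥ v
      size-U : suc (size G U′) ≡ size G U
      size-U = size-ᵥ U v v∈U
      size-U′ : size G U′ ≡ suc s
      size-U′ = ℕ.suc-injective (trans size-U size≡)
      counts′ : CliqueCounts U′
      counts′ = clique-counts chordal k4free s U′ size-U′ (remove-simplicial-connected U v simplicial U-connected)
      N⊆U′ : neighbourhood U v ⊆ᵥ U′
      N⊆U′ x∈N = let x∈U , v~x = ∈-neighbourhood⁻ U v x∈N in ∈-ᵥ⁺ U v (~-irrefl (~-sym v~x)) x∈U
      degree≥1 : 1 ≤ degree
      degree≥1 with size≥1⇒∈ U′ (subst (1 ≤_) (sym size-U′) (s≤s z≤n))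
      ... | y , y∈U′ with ∈-ᵥ⁻ U v y∈U′
      ...   | y≢v , y∈U with U-connected v∈U y∈U
      ...     | here                = ⊥-elim (y≢v refl)
      ...     | step w∈U v~w _      = ∈⇒size≥1 (neighbourhood U v) (∈-neighbourhood⁺ U v w∈U v~w)
      after-removal : (cliqueCountIn U 2 + 1 ≡ suc (size G U′) + cliqueCountIn U 3)
                    × (cliqueCountIn U 3 ≡ 0 ⊎ cliqueCountIn U 3 + 2 ≤ suc (size G U′))
      after-removal = counts-step degree degree≥1 (degree≤2 k4free)
        (λ degree≡2 → subst (_≤ size G U′) degree≡2 (size-mono (neighbourhood U v) U′ N⊆U′))
        (trans (cliqueCountIn-remove 1) (cong (cliqueCountIn U′ 2 +_) (choose-1 degree)))
        (cliqueCountIn-remove 2) (CliqueCounts.euler counts′) (CliqueCounts.triangles counts′)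

  connected⇒connectedIn-⊤ : Connected G → ConnectedIn (replicate n true)
  connected⇒connectedIn-⊤ connected {x} {y} _ _ = within-⊤ (connected x y)
    where
    within-⊤ : ∀ {x y} → Walk G x y → WalkIn (_∈ᵥ replicate n true) x y
    within-⊤ here              = here
    within-⊤ (step {w = w} x~w ω) = step (Vec.lookup-replicate w true) x~w (within-⊤ ω)

  edges-triangles : Connected G → Chordal G → K4Free G → ∀ m → n ≡ suc m →
    cliqueCount G 2 ≡ m + cliqueCount G 3 × 4 * cliqueCount G 3 ≤ m * m
  edges-triangles connected chordal k4free m n≡1+m = edges , bound
    where
    ⊤ = replicate n true
    size-⊤ : size G ⊤ ≡ suc m
    size-⊤ = trans (size-replicate n) n≡1+m
    counts : CliqueCounts ⊤
    counts = clique-counts chordal k4free m ⊤ size-⊤ (connected⇒connectedIn-⊤ connected)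
    t = cliqueCount G 3
    t≡ : t ≡ cliqueCountIn ⊤ 3
    t≡ = cliqueCount≡cliqueCountIn-⊤ 3
    edges : cliqueCount G 2 ≡ m + t
    edges = ℕ.suc-injective (begin
      suc (cliqueCount G 2)           ≡⟨ ℕ.+-comm 1 _ ⟩
      cliqueCount G 2 + 1             ≡⟨ cong (_+ 1) (cliqueCount≡cliqueCountIn-⊤ 2) ⟩
      cliqueCountIn ⊤ 2 + 1           ≡⟨ CliqueCounts.euler counts ⟩
      size G ⊤ + cliqueCountIn ⊤ 3    ≡⟨ cong₂ _+_ size-⊤ (sym t≡) ⟩
      suc m + t                       ∎)
      where open ≡-Reasoning
    bound : 4 * t ≤ m * m
    bound with CliqueCounts.triangles counts
    ... | inj₁ t≡0       = subst (λ t → 4 * t ≤ m * m) (sym (trans t≡ t≡0)) z≤n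
    ... | inj₂ t+2≤size  = discriminant-nonneg t m (subst₂ (λ c s → c + 2 ≤ s) (sym t≡) size-⊤ t+2≤size)

-- The clique polynomial

mutual
  -- The local helper `go` of `cliqueCoeffs` cannot be named; unification
  -- against the clause of `cliqueCoeffs-unfold` solves `coeffsFrom` to it.
  coeffsFrom : Graph → ℕ → ℕ → List ℕ
  coeffsFrom = _

  cliqueCoeffs-unfold : ∀ G → cliqueCoeffs G ≡ cliqueCount G 0 ∷ coeffsFrom G (Graph.n G) 1
  cliqueCoeffs-unfold record { n = n ; adj = adj ; sym = s ; irrefl = i }
    with record { n = n ; adj = adj ; sym = s ; irrefl = i } | 1
  ... | G | k = refl

coeffsFrom-snoc : ∀ G r k → coeffsFrom G (suc r) k ≡ coeffsFrom G r k ++ cliqueCount G (r + k) ∷ []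
coeffsFrom-snoc G zero    k = refl
coeffsFrom-snoc G (suc r) k = cong (cliqueCount G k ∷_)
  (trans (coeffsFrom-snoc G r (suc k)) (cong (λ j → coeffsFrom G r (suc k) ++ cliqueCount G j ∷ []) (ℕ.+-suc r k)))

module _ {c ℓ₁ ℓ₂} (ℝ : RealField c ℓ₁ ℓ₂) where
  open Complex ℝ
  open RealField-Properties ℝ

  eval-coeffsFrom-vanishing : ∀ G {r r′} → r ≤′ r′ → (∀ j → r ≤ j → cliqueCount G j ≡ 0) →
    ∀ z → eval (coeffsFrom G r′ 0) z ≈ᶜ eval (coeffsFrom G r 0) z
  eval-coeffsFrom-vanishing G ≤′-refl vanish z = ≈ᶜ-refl
  eval-coeffsFrom-vanishing G {r} (≤′-step {r′} r≤′r′) vanish z =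
    subst (λ xs → eval xs z ≈ᶜ eval (coeffsFrom G r 0) z) (sym extend)
      (≈ᶜ-trans (eval-++-0 (coeffsFrom G r′ 0) z) (eval-coeffsFrom-vanishing G r≤′r′ vanish z))
    where
    extend : coeffsFrom G (suc r′) 0 ≡ coeffsFrom G r′ 0 ++ 0 ∷ []
    extend = trans (coeffsFrom-snoc G r′ 0)
      (cong (λ c → coeffsFrom G r′ 0 ++ c ∷ [])
            (vanish (r′ + 0) (ℕ.≤-trans (ℕ.≤′⇒≤ r≤′r′) (ℕ.m≤m+n r′ 0))))

proposition5 : ∀ {c ℓ₁ ℓ₂ : Level} (ℝ : RealField c ℓ₁ ℓ₂) (G : Graph) →
    Connected G → Chordal G → K4Free G → OnlyCliqueRoots ℝ G
proposition5 ℝ G@record { n = zero } _ _ _ z root =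
  ⊥-elim (1-noRoot z (subst (λ c → IsRoot (c ∷ []) z) (Cliques.cliqueCount-0 G) root′))
  where
  open Complex ℝ
  open RealField-Properties ℝ
  root′ : IsRoot (cliqueCount G 0 ∷ []) z
  root′ = subst (λ xs → IsRoot xs z) (cliqueCoeffs-unfold G) root
proposition5 ℝ G@record { n = suc m } connected chordal k4free z root =
  cubic-onlyRealRoots m t (proj₂ counts) z (subst (λ xs → IsRoot xs z) coefficients root₄)
  where
  open Complex ℝ
  open RealField-Properties ℝ
  open Cliques G
  open Counting G
  t = cliqueCount G 3
  counts = edges-triangles connected chordal k4free m refl
  coefficients : coeffsFrom G 4 0 ≡ 1 ∷ suc m ∷ m + t ∷ t ∷ []
  coefficients = cong₂ _∷_ cliqueCount-0 (cong₂ _∷_ cliqueCount-1 (cong (_∷ t ∷ []) (proj₁ counts)))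
  truncate : eval (coeffsFrom G (suc (suc m)) 0) z ≈ᶜ eval (coeffsFrom G 4 0) z
  truncate with ℕ.≤-total 4 (suc (suc m))
  ... | inj₁ 4≤n+1 = eval-coeffsFrom-vanishing ℝ G (ℕ.≤⇒≤′ 4≤n+1) (cliqueCount-≥4 k4free) z
  ... | inj₂ n+1≤4 = ≈ᶜ-sym (eval-coeffsFrom-vanishing ℝ G (ℕ.≤⇒≤′ n+1≤4) cliqueCount-> z)
  root₄ : IsRoot (coeffsFrom G 4 0) z
  root₄ = IsRoot-resp (coeffsFrom G (suc (suc m)) 0) (coeffsFrom G 4 0) truncate
                      (subst (λ xs → IsRoot xs z) (cliqueCoeffs-unfold G) root)
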